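{- Let $J_1, J_2, \ldots, J_k$ and $J'_1, J'_2, \ldots, J'_l$ be graphs. Then there is a finite set $\mathcal{J}$ of graphs, each with at most \[K=1+\sum_{i=1}^k |V(J_i)| + \sum_{j=1}^l |V(J'_j)| \] vertices, and real constants $m_J$ for each $J\in \mathcal{J}$ (not depending on $G$), such that \[ \sum_{v\in V(G)} \prod_{i=1}^k s(J_i,G^-_v) \prod_{j=1}^l s(J'_j,G^+_v) = \sum_{J\in \mathcal{J}} m_J\, j(J,G) \] for every graph $G$.
   Context: All graphs are finite and simple. For graphs $J,G$, $s(J,G)$ denotes the number of induced subgraphs of $G$ isomorphic to $J$. For a vertex $v$ of $G$, $G^+_v$ is the subgraph of $G$ induced by the vertices adjacent to $v$, and $G^-_v$ is the subgraph of $G$ induced by the vertices different from $v$ and not adjacent to $v$. For graphs $J$ and $G$, \[ j(J,G)=\sum_{\phi} (-1)^{|\{uv\in E(J)\,:\, \phi(u)\phi(v)\notin E(G)\}|}, \] where $\phi$ ranges over all injective maps $V(J)\to V(G)$. -}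

module Defs where

open import Data.Nat as ℕ using (ℕ; zero; suc)
open import Data.Bool using (Bool; true; false; not; _∧_; _∨_; if_then_else_)
import Data.Bool as B
open import Data.Fin as F using (Fin; toℕ)
open import Data.Vec as V using (Vec; []; _∷_; lookup)
open import Data.List as L using (List; []; _∷_; map; concatMap; allFin; filterᵇ; length; foldr)
open import Data.Integer as ℤ using (ℤ; +_)
open import Data.Rational as ℚ using (ℚ)
open import Data.Nat.ListAction using (sum; product)
open import Data.Product using (_×_; _,_; proj₁; proj₂)
open import Relation.Nullary.Decidable using (isYes)
open import Relation.Binary.PropositionalEquality using (_≡_)

record Graph : Set where
  field
    n     : ℕ
    adj   : Fin n → Fin n → Bool
    sym   : ∀ i j → adj i j ≡ adj j i
    irref : ∀ i → adj i i ≡ false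
open Graph public

-- Subgraph of G induced by a (duplicate-free) list of its vertices.
induced : (G : Graph) → List (Fin (n G)) → Graph
induced G xs = record
  { n = length xs
  ; adj = λ a b → adj G (L.lookup xs a) (L.lookup xs b)
  ; sym = λ a b → sym G (L.lookup xs a) (L.lookup xs b)
  ; irref = λ a → irref G (L.lookup xs a) }

_=ᶠ_ : ∀ {k} → Fin k → Fin k → Bool
a =ᶠ b = isYes (a F.≟ b)

_=ᵇ_ : Bool → Bool → Bool
a =ᵇ b = isYes (a B.≟ b)

plus : (G : Graph) → Fin (n G) → Graph
plus G v = induced G (filterᵇ (λ u → adj G v u) (allFin (n G)))

minus : (G : Graph) → Fin (n G) → Graph
minus G v = induced G (filterᵇ (λ u → not (adj G v u) ∧ not (u =ᶠ v)) (allFin (n G)))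

allVecs : (A : Set) → List A → (m : ℕ) → List (Vec A m)
allVecs A xs zero = [] ∷ []
allVecs A xs (suc m) = concatMap (λ x → map (x ∷_) (allVecs A xs m)) xs

allB : ∀ {k} → (Fin k → Bool) → Bool
allB {k} p = foldr (λ a r → p a ∧ r) true (allFin k)

anyL : ∀ {A : Set} → (A → Bool) → List A → Bool
anyL p xs = foldr (λ a r → p a ∨ r) false xs

countL : ∀ {A : Set} → (A → Bool) → List A → ℕ
countL p xs = length (filterᵇ p xs)

-- injective maps V(J) → V(G), represented as vectors
injective : ∀ {m k} → Vec (Fin k) m → Bool
injective φ = allB (λ a → allB (λ b → a =ᶠ b ∨ not (lookup φ a =ᶠ lookup φ b)))

isoOnto : (J G : Graph) → Vec (Fin (n G)) (n J) → Vec Bool (n G) → Bool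
isoOnto J G φ S =
  injective φ
  ∧ allB (λ x → lookup S x =ᵇ anyL (λ a → lookup φ a =ᶠ x) (allFin (n J)))
  ∧ allB (λ a → allB (λ b → adj J a b =ᵇ adj G (lookup φ a) (lookup φ b)))

s : Graph → Graph → ℕ
s J G = countL (λ S → anyL (λ φ → isoOnto J G φ S) (allVecs (Fin (n G)) (allFin (n G)) (n J)))
               (allVecs Bool (true ∷ false ∷ []) (n G))

neg1^ : ℕ → ℤ
neg1^ zero = + 1
neg1^ (suc k) = ℤ.- neg1^ k

badEdges : (J G : Graph) → Vec (Fin (n G)) (n J) → ℕ
badEdges J G φ =
  countL (λ ab → isYes (toℕ (proj₁ ab) ℕ.<? toℕ (proj₂ ab))
                 ∧ adj J (proj₁ ab) (proj₂ ab)
                 ∧ not (adj G (lookup φ (proj₁ ab)) (lookup φ (proj₂ ab))))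
         (concatMap (λ a → map (a ,_) (allFin (n J))) (allFin (n J)))

sumℤ : List ℤ → ℤ
sumℤ = foldr ℤ._+_ (+ 0)

jj : Graph → Graph → ℤ
jj J G = sumℤ (map (λ φ → neg1^ (badEdges J G φ))
                   (filterᵇ injective (allVecs (Fin (n G)) (allFin (n G)) (n J))))

lhs : List Graph → List Graph → Graph → ℕ
lhs Js Js' G = sum (map (λ v → product (map (λ J → s J (minus G v)) Js)
                                ℕ.* product (map (λ J → s J (plus G v)) Js'))
                          (allFin (n G)))

bigK : List Graph → List Graph → ℕ
bigK Js Js' = 1 ℕ.+ sum (map n Js) ℕ.+ sum (map n Js')

rhs : List (Graph × ℚ) → Graph → ℚ
rhs 𝒥 G = foldr (λ p r → proj₂ p ℚ.* (jj (proj₁ p) G ℚ./ 1) ℚ.+ r) ℚ.0ℚ 𝒥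

module Submission where

open import Defs
open import Data.Nat using (ℕ; _≤_)
open import Data.Integer using (+_)
open import Data.Rational using (ℚ; _/_)
open import Data.List using (List)
open import Data.List.Relation.Unary.All using (All)
open import Data.Product using (_×_; ∃-syntax; proj₁)
open import Relation.Binary.PropositionalEquality using (_≡_)

-- Write  pat G ψ  for the "pattern" of a tuple ψ of vertices of G:
-- for every pair of positions, whether the two entries are equal and whether
-- they are adjacent.  A graph parameter is *K-expressible* if it is a fixed
-- rational combination of the j(J,·) with |V(J)| ≤ K.
--
--  (A) Every pattern sum  G ↦ Σ_{ψ ∈ V(G)^m} h (pat G ψ)  is m-expressible.
--      For injective ψ the pattern is just the adjacency matrix of ψ; Fourier
--      expanding h over ±1-characters of Boolean matrices turns each term into
--      ± j(J_F,G) for a graph J_F read off the character.  Arbitrary tuples are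
--      reduced to injective ones by induction, each new entry being either a
--      fresh vertex or a repetition of an earlier entry.
--  (B) s(J,H)·aut(J) counts the embeddings of J into H (injective tuples
--      preserving adjacency and non-adjacency), and for H = G⁺_v or G⁻_v
--      these are tuples ψ of G whose membership in H is decided by the
--      pattern of (v,ψ).  Hence v ↦ s(J,G^±_v) is a "rooted
--      pattern sum" of arity |V(J)|, and rooted pattern sums are closed under
--      products.
--  Summing (B) over v gives a pattern sum of arity K, and (A) finishes.

import Data.Nat as Nat
import Data.Nat.Properties as NatP
open import Data.Nat.ListAction using (sum; product)
open import Data.Bool using (Bool; true; false; T; not; _∧_; _∨_; if_then_else_; _xor_)
import Data.Bool.Properties as BoolP
open import Data.Fin as Fin using (Fin; zero; suc; toℕ; _↑ˡ_; _↑ʳ_)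
import Data.Fin.Properties as FinP
open import Data.Vec as Vec using (Vec; []; _∷_; lookup; tabulate; _++_)
import Data.Vec.Properties as VecP
open import Data.List as List using ([]; _∷_; allFin; filterᵇ; concatMap)
import Data.List.Properties as ListP
open import Data.List.Membership.Propositional using (_∈_; lose)
open import Data.List.Membership.Propositional.Properties using (∈-allFin; ∈-lookup; ∈-map⁺; ∈-concatMap⁺)
open import Data.List.Relation.Unary.Any using (here; there)
import Data.List.Relation.Unary.All as All
import Data.List.Relation.Unary.All.Properties as AllP
open import Data.List.Relation.Unary.Unique.Propositional using (Unique)
import Data.List.Relation.Unary.Unique.Propositional.Properties as UniqueP
import Data.List.Relation.Unary.AllPairs as AllPairs
open import Data.Integer as ℤ using (ℤ)
import Data.Integer.Properties as ℤP
open import Data.Rational as ℚ using (0ℚ; 1ℚ; _+_; _*_; -_; 1/_)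
import Data.Rational.Properties as ℚP
open import Data.Rational.Solver using (module +-*-Solver)
import Data.Nat.Coprimality as Coprime
open import Data.Product using (Σ; _,_; proj₂; ∃)
open import Data.Sum using (_⊎_; inj₁; inj₂; [_,_]′)
open import Data.Empty using (⊥; ⊥-elim)
open import Relation.Nullary using (yes; no; ¬_; isYes; T?)
open import Relation.Binary using (tri<; tri≈; tri>)
open import Relation.Binary.PropositionalEquality
  using (_≢_; refl; trans; cong; cong₂; subst; module ≡-Reasoning) renaming (sym to ≡-sym)
open import Function using (_∘_; id)

open ≡-Reasoning

ΣL : {A : Set} → List A → (A → ℚ) → ℚ
ΣL [] f = 0ℚ
ΣL (x ∷ xs) f = f x + ΣL xs f

ΠL : {A : Set} → List A → (A → ℚ) → ℚ
ΠL [] f = 1ℚ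
ΠL (x ∷ xs) f = f x * ΠL xs f

[_] : Bool → ℚ
[ true ] = 1ℚ
[ false ] = 0ℚ

-1ℚ : ℚ
-1ℚ = - 1ℚ

ΣL-cong : {A : Set} (xs : List A) {f g : A → ℚ} → (∀ x → f x ≡ g x) → ΣL xs f ≡ ΣL xs g
ΣL-cong [] e = refl
ΣL-cong (x ∷ xs) e = cong₂ _+_ (e x) (ΣL-cong xs e)

ΠL-cong : {A : Set} (xs : List A) {f g : A → ℚ} → (∀ x → f x ≡ g x) → ΠL xs f ≡ ΠL xs g
ΠL-cong [] e = refl
ΠL-cong (x ∷ xs) e = cong₂ _*_ (e x) (ΠL-cong xs e)

+-interchange : ∀ a b c d → (a + b) + (c + d) ≡ (a + c) + (b + d)
+-interchange = solve 4 (λ a b c d → (a :+ b) :+ (c :+ d) := (a :+ c) :+ (b :+ d)) refl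
  where open +-*-Solver

*-interchange : ∀ a b c d → (a * b) * (c * d) ≡ (a * c) * (b * d)
*-interchange = solve 4 (λ a b c d → (a :* b) :* (c :* d) := (a :* c) :* (b :* d)) refl
  where open +-*-Solver

ΣL-+ : {A : Set} (xs : List A) (f g : A → ℚ) → ΣL xs (λ x → f x + g x) ≡ ΣL xs f + ΣL xs g
ΣL-+ [] f g = refl
ΣL-+ (x ∷ xs) f g =
  trans (cong (λ z → (f x + g x) + z) (ΣL-+ xs f g)) (+-interchange (f x) (g x) (ΣL xs f) (ΣL xs g))

ΣL-*ˡ : {A : Set} (c : ℚ) (xs : List A) (f : A → ℚ) → c * ΣL xs f ≡ ΣL xs (λ x → c * f x)
ΣL-*ˡ c [] f = ℚP.*-zeroʳ c
ΣL-*ˡ c (x ∷ xs) f =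
  trans (ℚP.*-distribˡ-+ c (f x) (ΣL xs f)) (cong (λ z → c * f x + z) (ΣL-*ˡ c xs f))

ΣL-*ʳ : {A : Set} (c : ℚ) (xs : List A) (f : A → ℚ) → ΣL xs f * c ≡ ΣL xs (λ x → f x * c)
ΣL-*ʳ c xs f =
  trans (ℚP.*-comm (ΣL xs f) c) (trans (ΣL-*ˡ c xs f) (ΣL-cong xs (λ x → ℚP.*-comm c (f x))))

ΣL-0 : {A : Set} (xs : List A) → ΣL xs (λ _ → 0ℚ) ≡ 0ℚ
ΣL-0 [] = refl
ΣL-0 (x ∷ xs) = trans (ℚP.+-identityˡ _) (ΣL-0 xs)

ΣL-++ : {A : Set} (xs ys : List A) (f : A → ℚ) → ΣL (xs List.++ ys) f ≡ ΣL xs f + ΣL ys f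
ΣL-++ [] ys f = ≡-sym (ℚP.+-identityˡ _)
ΣL-++ (x ∷ xs) ys f = trans (cong (λ z → f x + z) (ΣL-++ xs ys f)) (≡-sym (ℚP.+-assoc (f x) _ _))

ΣL-map : {A B : Set} (g : A → B) (xs : List A) (f : B → ℚ) → ΣL (List.map g xs) f ≡ ΣL xs (f ∘ g)
ΣL-map g [] f = refl
ΣL-map g (x ∷ xs) f = cong (λ z → f (g x) + z) (ΣL-map g xs f)

ΣL-concatMap : {A B : Set} (g : A → List B) (xs : List A) (f : B → ℚ) →
  ΣL (concatMap g xs) f ≡ ΣL xs (λ x → ΣL (g x) f)
ΣL-concatMap g [] f = refl
ΣL-concatMap g (x ∷ xs) f =
  trans (ΣL-++ (g x) (concatMap g xs) f) (cong (λ z → ΣL (g x) f + z) (ΣL-concatMap g xs f))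

ΣL-swap : {A B : Set} (xs : List A) (ys : List B) (f : A → B → ℚ) →
  ΣL xs (λ x → ΣL ys (f x)) ≡ ΣL ys (λ y → ΣL xs (λ x → f x y))
ΣL-swap [] ys f = ≡-sym (ΣL-0 ys)
ΣL-swap (x ∷ xs) ys f =
  trans (cong (λ z → ΣL ys (f x) + z) (ΣL-swap xs ys f)) (≡-sym (ΣL-+ ys (f x) _))

ΣL-filter : {A : Set} (p : A → Bool) (xs : List A) (f : A → ℚ) →
  ΣL (filterᵇ p xs) f ≡ ΣL xs (λ x → [ p x ] * f x)
ΣL-filter p [] f = refl
ΣL-filter p (x ∷ xs) f with p x
... | true = cong₂ _+_ (≡-sym (ℚP.*-identityˡ (f x))) (ΣL-filter p xs f)
... | false = trans (ΣL-filter p xs f)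
  (trans (≡-sym (ℚP.+-identityˡ _)) (cong (_+ ΣL xs (λ x → [ p x ] * f x)) (≡-sym (ℚP.*-zeroˡ (f x)))))

ΠL-* : {A : Set} (xs : List A) (f g : A → ℚ) → ΠL xs (λ x → f x * g x) ≡ ΠL xs f * ΠL xs g
ΠL-* [] f g = refl
ΠL-* (x ∷ xs) f g =
  trans (cong ((f x * g x) *_) (ΠL-* xs f g)) (*-interchange (f x) (g x) (ΠL xs f) (ΠL xs g))

ΠL-++ : {A : Set} (xs ys : List A) (f : A → ℚ) → ΠL (xs List.++ ys) f ≡ ΠL xs f * ΠL ys f
ΠL-++ [] ys f = ≡-sym (ℚP.*-identityˡ _)
ΠL-++ (x ∷ xs) ys f = trans (cong (f x *_) (ΠL-++ xs ys f)) (≡-sym (ℚP.*-assoc (f x) _ _))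

ΠL-map : {A B : Set} (g : A → B) (xs : List A) (f : B → ℚ) → ΠL (List.map g xs) f ≡ ΠL xs (f ∘ g)
ΠL-map g [] f = refl
ΠL-map g (x ∷ xs) f = cong (f (g x) *_) (ΠL-map g xs f)

ΠL-concatMap : {A B : Set} (g : A → List B) (xs : List A) (f : B → ℚ) →
  ΠL (concatMap g xs) f ≡ ΠL xs (λ x → ΠL (g x) f)
ΠL-concatMap g [] f = refl
ΠL-concatMap g (x ∷ xs) f =
  trans (ΠL-++ (g x) (concatMap g xs) f) (cong (ΠL (g x) f *_) (ΠL-concatMap g xs f))

ΠL-1 : {A : Set} (xs : List A) → ΠL xs (λ _ → 1ℚ) ≡ 1ℚ
ΠL-1 [] = refl
ΠL-1 (x ∷ xs) = trans (ℚP.*-identityˡ _) (ΠL-1 xs)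

ΠL-swap : {A B : Set} (xs : List A) (ys : List B) (f : A → B → ℚ) →
  ΠL xs (λ x → ΠL ys (f x)) ≡ ΠL ys (λ y → ΠL xs (λ x → f x y))
ΠL-swap [] ys f = ≡-sym (ΠL-1 ys)
ΠL-swap (x ∷ xs) ys f =
  trans (cong (ΠL ys (f x) *_) (ΠL-swap xs ys f)) (≡-sym (ΠL-* ys (f x) _))

allFin-suc : ∀ n → List.tabulate {n = n} suc ≡ List.map suc (allFin n)
allFin-suc n = ≡-sym (ListP.map-tabulate id suc)

ΣFin-suc : ∀ n (f : Fin (ℕ.suc n) → ℚ) → ΣL (allFin (ℕ.suc n)) f ≡ f zero + ΣL (allFin n) (f ∘ suc)
ΣFin-suc n f = cong (λ z → f zero + z) (trans (cong (λ l → ΣL l f) (allFin-suc n)) (ΣL-map suc (allFin n) f))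

ΠFin-suc : ∀ n (f : Fin (ℕ.suc n) → ℚ) → ΠL (allFin (ℕ.suc n)) f ≡ f zero * ΠL (allFin n) (f ∘ suc)
ΠFin-suc n f = cong (f zero *_) (trans (cong (λ l → ΠL l f) (allFin-suc n)) (ΠL-map suc (allFin n) f))

=ᶠ-refl : ∀ {k} (a : Fin k) → (a =ᶠ a) ≡ true
=ᶠ-refl a with a Fin.≟ a
... | yes _ = refl
... | no a≢a = ⊥-elim (a≢a refl)

=ᶠ-suc : ∀ {k} (a b : Fin k) → (suc a =ᶠ suc b) ≡ (a =ᶠ b)
=ᶠ-suc a b with a Fin.≟ b
... | yes _ = refl
... | no _ = refl

=ᶠ-true : ∀ {k} {a b : Fin k} → (a =ᶠ b) ≡ true → a ≡ b
=ᶠ-true {a = a} {b} e with a Fin.≟ b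
... | yes a≡b = a≡b

=ᶠ-false : ∀ {k} {a b : Fin k} → a ≢ b → (a =ᶠ b) ≡ false
=ᶠ-false {a = a} {b} a≢b with a Fin.≟ b
... | yes a≡b = ⊥-elim (a≢b a≡b)
... | no _ = refl

=ᶠ-sym : ∀ {k} (a b : Fin k) → (a =ᶠ b) ≡ (b =ᶠ a)
=ᶠ-sym a b with a Fin.≟ b | b Fin.≟ a
... | yes _ | yes _ = refl
... | yes a≡b | no b≢a = ⊥-elim (b≢a (≡-sym a≡b))
... | no a≢b | yes b≡a = ⊥-elim (a≢b (≡-sym b≡a))
... | no _ | no _ = refl

=ᵇ-true : ∀ {a b : Bool} → (a =ᵇ b) ≡ true → a ≡ b
=ᵇ-true {a} {b} e with a BoolP.≟ b
... | yes a≡b = a≡b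

=ᵇ-refl : ∀ (a : Bool) → (a =ᵇ a) ≡ true
=ᵇ-refl true = refl
=ᵇ-refl false = refl

bool-ext : {b c : Bool} → (b ≡ true → c ≡ true) → (c ≡ true → b ≡ true) → b ≡ c
bool-ext {false} {false} _ _ = refl
bool-ext {false} {true} _ c⇒b = c⇒b refl
bool-ext {true} {false} b⇒c _ = ≡-sym (b⇒c refl)
bool-ext {true} {true} _ _ = refl

∧-true : ∀ {a b : Bool} → a ∧ b ≡ true → a ≡ true × b ≡ true
∧-true {a} {b} e = BoolP.∧-conicalˡ a b e , BoolP.∧-conicalʳ a b e

∧-intro : ∀ {a b : Bool} → a ≡ true → b ≡ true → a ∧ b ≡ true
∧-intro refl refl = refl

not-true : ∀ {a : Bool} → not a ≡ true → a ≡ false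
not-true {false} _ = refl

false≢true : ∀ {a : Bool} → a ≡ false → a ≡ true → ⊥
false≢true refl ()

[∧] : (a b : Bool) → [ a ∧ b ] ≡ [ a ] * [ b ]
[∧] true b = ≡-sym (ℚP.*-identityˡ [ b ])
[∧] false b = ≡-sym (ℚP.*-zeroˡ [ b ])

allB-true : ∀ {k} (p : Fin k → Bool) → allB p ≡ true → ∀ a → p a ≡ true
allB-true {k} p e a = go (allFin k) e (∈-allFin a)
  where
  go : (xs : List (Fin k)) → List.foldr (λ a r → p a ∧ r) true xs ≡ true → a ∈ xs → p a ≡ true
  go (x ∷ xs) e (here refl) = proj₁ (∧-true {p x} e)
  go (x ∷ xs) e (there a∈xs) = go xs (proj₂ (∧-true {p x} e)) a∈xs

allB-intro : ∀ {k} (p : Fin k → Bool) → (∀ a → p a ≡ true) → allB p ≡ true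
allB-intro {k} p h = go (allFin k)
  where
  go : (xs : List (Fin k)) → List.foldr (λ a r → p a ∧ r) true xs ≡ true
  go [] = refl
  go (x ∷ xs) = ∧-intro (h x) (go xs)

allB-cong : ∀ {k} (p q : Fin k → Bool) → (∀ a → p a ≡ q a) → allB p ≡ allB q
allB-cong {k} p q h = go (allFin k)
  where
  go : (xs : List (Fin k)) → List.foldr (λ a r → p a ∧ r) true xs ≡ List.foldr (λ a r → q a ∧ r) true xs
  go [] = refl
  go (x ∷ xs) = cong₂ _∧_ (h x) (go xs)

allB-suc : ∀ {k} (p : Fin (ℕ.suc k) → Bool) → allB p ≡ p zero ∧ allB (p ∘ suc)
allB-suc p = bool-ext
  (λ e → ∧-intro (allB-true p e zero) (allB-intro (p ∘ suc) (λ a → allB-true p e (suc a))))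
  (λ e → let (e₀ , eₛ) = ∧-true {p zero} e in
         allB-intro p (λ { zero → e₀ ; (suc a) → allB-true (p ∘ suc) eₛ a }))

anyL-true : {A : Set} (p : A → Bool) (xs : List A) → anyL p xs ≡ true → Σ A (λ x → x ∈ xs × p x ≡ true)
anyL-true p (x ∷ xs) e with p x in px
... | true = x , here refl , px
... | false = let (y , y∈xs , py) = anyL-true p xs e in y , there y∈xs , py

anyL-intro : {A : Set} (p : A → Bool) (xs : List A) (x : A) → x ∈ xs → p x ≡ true → anyL p xs ≡ true
anyL-intro p (y ∷ xs) x (here refl) px rewrite px = refl
anyL-intro p (y ∷ xs) x (there x∈xs) px with p y
... | true = refl
... | false = anyL-intro p xs x x∈xs px

anyL-map : {A B : Set} (p : B → Bool) (f : A → B) (xs : List A) → anyL p (List.map f xs) ≡ anyL (p ∘ f) xs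
anyL-map p f [] = refl
anyL-map p f (x ∷ xs) = cong (p (f x) ∨_) (anyL-map p f xs)

anyL-suc : ∀ r (p : Fin (ℕ.suc r) → Bool) → anyL p (allFin (ℕ.suc r)) ≡ p zero ∨ anyL (p ∘ suc) (allFin r)
anyL-suc r p = cong (p zero ∨_) (trans (cong (anyL p) (allFin-suc r)) (anyL-map p suc (allFin r)))

anyL-false : {A : Set} (p : A → Bool) (xs : List A) → anyL p xs ≡ false → ΣL xs (λ x → [ p x ]) ≡ 0ℚ
anyL-false p [] _ = refl
anyL-false p (x ∷ xs) e with p x
... | false = trans (ℚP.+-identityˡ _) (anyL-false p xs e)

ΣVec-zero : {A : Set} (X : List A) (F : Vec A 0 → ℚ) → ΣL (allVecs A X 0) F ≡ F []
ΣVec-zero X F = ℚP.+-identityʳ _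

ΣVec-suc : {A : Set} (X : List A) (m : ℕ) (F : Vec A (ℕ.suc m) → ℚ) →
  ΣL (allVecs A X (ℕ.suc m)) F ≡ ΣL X (λ x → ΣL (allVecs A X m) (λ ψ → F (x ∷ ψ)))
ΣVec-suc X m F = trans (ΣL-concatMap _ X F) (ΣL-cong X (λ x → ΣL-map (x ∷_) (allVecs _ X m) F))

ΣVec-++ : {A : Set} (X : List A) (m k : ℕ) (F : Vec A (m Nat.+ k) → ℚ) →
  ΣL (allVecs A X (m Nat.+ k)) F ≡ ΣL (allVecs A X m) (λ ψ₁ → ΣL (allVecs A X k) (λ ψ₂ → F (ψ₁ ++ ψ₂)))
ΣVec-++ X ℕ.zero k F = ≡-sym (ΣVec-zero X (λ ψ₁ → ΣL (allVecs _ X k) (λ ψ₂ → F (ψ₁ ++ ψ₂))))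
ΣVec-++ X (ℕ.suc m) k F = begin
  ΣL (allVecs _ X (ℕ.suc m Nat.+ k)) F
    ≡⟨ ΣVec-suc X (m Nat.+ k) F ⟩
  ΣL X (λ x → ΣL (allVecs _ X (m Nat.+ k)) (λ ψ → F (x ∷ ψ)))
    ≡⟨ ΣL-cong X (λ x → ΣVec-++ X m k (λ ψ → F (x ∷ ψ))) ⟩
  ΣL X (λ x → ΣL (allVecs _ X m) (λ ψ₁ → ΣL (allVecs _ X k) (λ ψ₂ → F (x ∷ ψ₁ ++ ψ₂))))
    ≡⟨ ≡-sym (ΣVec-suc X m (λ ψ₁ → ΣL (allVecs _ X k) (λ ψ₂ → F (ψ₁ ++ ψ₂)))) ⟩
  ΣL (allVecs _ X (ℕ.suc m)) (λ ψ₁ → ΣL (allVecs _ X k) (λ ψ₂ → F (ψ₁ ++ ψ₂))) ∎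

IsDelta : {A : Set} → List A → (A → A → ℚ) → Set
IsDelta {A} X D = ∀ (k : A → ℚ) u → ΣL X (λ w → k w * D w u) ≡ k u

δVec : {A : Set} (D : A → A → ℚ) {m : ℕ} → Vec A m → Vec A m → ℚ
δVec D [] [] = 1ℚ
δVec D (w ∷ ws) (u ∷ us) = D w u * δVec D ws us

δVec-isDelta : {A : Set} (X : List A) (D : A → A → ℚ) → IsDelta X D →
  ∀ m → IsDelta (allVecs A X m) (δVec D {m})
δVec-isDelta X D isδ ℕ.zero k [] = trans (ΣVec-zero X (λ w → k w * δVec D w [])) (ℚP.*-identityʳ _)
δVec-isDelta X D isδ (ℕ.suc m) k (u ∷ us) = begin
  ΣL (allVecs _ X (ℕ.suc m)) (λ w → k w * δVec D w (u ∷ us))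
    ≡⟨ ΣVec-suc X m (λ w → k w * δVec D w (u ∷ us)) ⟩
  ΣL X (λ x → ΣL (allVecs _ X m) (λ ψ → k (x ∷ ψ) * (D x u * δVec D ψ us)))
    ≡⟨ ΣL-cong X (λ x → trans (ΣL-cong (allVecs _ X m) (λ ψ → reassoc (k (x ∷ ψ)) (D x u) (δVec D ψ us)))
                                (≡-sym (ΣL-*ʳ (D x u) (allVecs _ X m) _))) ⟩
  ΣL X (λ x → ΣL (allVecs _ X m) (λ ψ → k (x ∷ ψ) * δVec D ψ us) * D x u)
    ≡⟨ ΣL-cong X (λ x → cong (_* D x u) (δVec-isDelta X D isδ m (λ ψ → k (x ∷ ψ)) us)) ⟩
  ΣL X (λ x → k (x ∷ us) * D x u)
    ≡⟨ isδ (λ x → k (x ∷ us)) u ⟩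
  k (u ∷ us) ∎
  where
  reassoc : ∀ a b c → a * (b * c) ≡ (a * c) * b
  reassoc = solve 3 (λ a b c → a :* (b :* c) := (a :* c) :* b) refl
    where open +-*-Solver

ΣFin-δ : ∀ n (x₀ : Fin n) (f : Fin n → ℚ) → ΣL (allFin n) (λ x → [ x =ᶠ x₀ ] * f x) ≡ f x₀
ΣFin-δ (ℕ.suc n) zero f = begin
  ΣL (allFin (ℕ.suc n)) (λ x → [ x =ᶠ zero ] * f x)
    ≡⟨ ΣFin-suc n (λ x → [ x =ᶠ zero ] * f x) ⟩
  1ℚ * f zero + ΣL (allFin n) (λ x → 0ℚ * f (suc x))
    ≡⟨ cong₂ _+_ (ℚP.*-identityˡ (f zero))
                 (trans (ΣL-cong (allFin n) (λ x → ℚP.*-zeroˡ (f (suc x)))) (ΣL-0 (allFin n))) ⟩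
  f zero + 0ℚ
    ≡⟨ ℚP.+-identityʳ _ ⟩
  f zero ∎
ΣFin-δ (ℕ.suc n) (suc y) f = begin
  ΣL (allFin (ℕ.suc n)) (λ x → [ x =ᶠ suc y ] * f x)
    ≡⟨ ΣFin-suc n (λ x → [ x =ᶠ suc y ] * f x) ⟩
  0ℚ * f zero + ΣL (allFin n) (λ x → [ suc x =ᶠ suc y ] * f (suc x))
    ≡⟨ cong₂ _+_ (ℚP.*-zeroˡ (f zero))
                 (trans (ΣL-cong (allFin n) (λ x → cong (λ b → [ b ] * f (suc x)) (=ᶠ-suc x y)))
                        (ΣFin-δ n y (f ∘ suc))) ⟩
  0ℚ + f (suc y)
    ≡⟨ ℚP.+-identityˡ _ ⟩
  f (suc y) ∎

finδ-isDelta : ∀ k → IsDelta (allFin k) (λ x y → [ x =ᶠ y ])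
finδ-isDelta k f u = trans (ΣL-cong (allFin k) (λ x → ℚP.*-comm (f x) _)) (ΣFin-δ k u f)

bools : List Bool
bools = true ∷ false ∷ []

boolδ-isDelta : IsDelta bools (λ x y → [ x =ᵇ y ])
boolδ-isDelta f true =
  trans (cong₂ _+_ (ℚP.*-identityʳ (f true)) (trans (ℚP.+-identityʳ _) (ℚP.*-zeroʳ (f false))))
        (ℚP.+-identityʳ (f true))
boolδ-isDelta f false =
  trans (cong₂ _+_ (ℚP.*-zeroʳ (f true)) (trans (ℚP.+-identityʳ _) (ℚP.*-identityʳ (f false))))
        (ℚP.+-identityˡ (f false))

vecEq : {A : Set} → (A → A → Bool) → {m : ℕ} → Vec A m → Vec A m → Bool
vecEq e [] [] = true
vecEq e (x ∷ xs) (y ∷ ys) = e x y ∧ vecEq e xs ys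

vecEq-sound : {A : Set} (e : A → A → Bool) → (∀ {x y} → e x y ≡ true → x ≡ y) →
  ∀ {m} {v w : Vec A m} → vecEq e v w ≡ true → v ≡ w
vecEq-sound e sound {v = []} {[]} _ = refl
vecEq-sound e sound {v = x ∷ v} {y ∷ w} eq =
  let (x≈y , v≈w) = ∧-true {e x y} eq in cong₂ _∷_ (sound x≈y) (vecEq-sound e sound v≈w)

vecEq-refl : {A : Set} (e : A → A → Bool) → (∀ x → e x x ≡ true) → ∀ {m} (v : Vec A m) → vecEq e v v ≡ true
vecEq-refl e refl-e [] = refl
vecEq-refl e refl-e (x ∷ v) = ∧-intro (refl-e x) (vecEq-refl e refl-e v)

allB-vecEq : {A : Set} (e : A → A → Bool) → ∀ {k} (v w : Vec A k) →
  allB (λ i → e (lookup v i) (lookup w i)) ≡ vecEq e v w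
allB-vecEq e [] [] = refl
allB-vecEq e (x ∷ v) (y ∷ w) =
  trans (allB-suc (λ i → e (lookup (x ∷ v) i) (lookup (y ∷ w) i))) (cong (e x y ∧_) (allB-vecEq e v w))

ΣVec-vecEq : {A : Set} (X : List A) (e : A → A → Bool) → IsDelta X (λ x y → [ e x y ]) →
  ∀ m (w : Vec A m) → ΣL (allVecs A X m) (λ v → [ vecEq e v w ]) ≡ 1ℚ
ΣVec-vecEq X e isδ m w =
  trans (ΣL-cong (allVecs _ X m) (λ v → trans (indicator v w) (≡-sym (ℚP.*-identityˡ _))))
        (δVec-isDelta X (λ x y → [ e x y ]) isδ m (λ _ → 1ℚ) w)
  where
  indicator : ∀ {m} (v w : Vec _ m) → [ vecEq e v w ] ≡ δVec (λ x y → [ e x y ]) v w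
  indicator [] [] = refl
  indicator (x ∷ v) (y ∷ w) = trans ([∧] (e x y) (vecEq e v w)) (cong ([ e x y ] *_) (indicator v w))

ι : ℤ → ℚ
ι z = z / 1

ι-mkℚ : ∀ z → ι z ≡ ℚ.mkℚ z 0 (Coprime.sym (Coprime.1-coprimeTo ℤ.∣ z ∣))
ι-mkℚ (+ n) = ℚP.normalize-coprime (Coprime.sym (Coprime.1-coprimeTo n))
ι-mkℚ ℤ.-[1+ n ] = cong -_ (ℚP.normalize-coprime (Coprime.sym (Coprime.1-coprimeTo (ℕ.suc n))))

ι-+ : ∀ a b → ι (a ℤ.+ b) ≡ ι a + ι b
ι-+ a b rewrite ι-mkℚ a | ι-mkℚ b =
  cong (_/ 1) (≡-sym (cong₂ ℤ._+_ (ℤP.*-identityʳ a) (ℤP.*-identityʳ b)))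

ι-* : ∀ a b → ι (a ℤ.* b) ≡ ι a * ι b
ι-* a b rewrite ι-mkℚ a | ι-mkℚ b = refl

ι-neg : ∀ a → ι (ℤ.- a) ≡ - ι a
ι-neg (+ ℕ.zero) = refl
ι-neg (+ ℕ.suc n) rewrite ι-mkℚ (ℤ.- (+ ℕ.suc n)) = refl
ι-neg ℤ.-[1+ n ] rewrite ι-mkℚ (+ ℕ.suc n) = refl

ιn : ℕ → ℚ
ιn k = ι (+ k)

ιn-+ : ∀ a b → ιn (a Nat.+ b) ≡ ιn a + ιn b
ιn-+ a b = trans (cong ι (ℤP.pos-+ a b)) (ι-+ (+ a) (+ b))

ιn-* : ∀ a b → ιn (a Nat.* b) ≡ ιn a * ιn b
ιn-* a b = trans (cong ι (ℤP.pos-* a b)) (ι-* (+ a) (+ b))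

ιn-sum : {A : Set} (f : A → ℕ) (xs : List A) → ιn (sum (List.map f xs)) ≡ ΣL xs (λ x → ιn (f x))
ιn-sum f [] = refl
ιn-sum f (x ∷ xs) = trans (ιn-+ (f x) _) (cong (λ z → ιn (f x) + z) (ιn-sum f xs))

ιn-product : {A : Set} (f : A → ℕ) (xs : List A) → ιn (product (List.map f xs)) ≡ ΠL xs (λ x → ιn (f x))
ιn-product f [] = refl
ιn-product f (x ∷ xs) = trans (ιn-* (f x) _) (cong (ιn (f x) *_) (ιn-product f xs))

ι-sumℤ : {A : Set} (f : A → ℤ) (xs : List A) → ι (sumℤ (List.map f xs)) ≡ ΣL xs (λ x → ι (f x))
ι-sumℤ f [] = refl
ι-sumℤ f (x ∷ xs) = trans (ι-+ (f x) _) (cong (λ z → ι (f x) + z) (ι-sumℤ f xs))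

ι-countL : {A : Set} (p : A → Bool) (xs : List A) → ιn (countL p xs) ≡ ΣL xs (λ x → [ p x ])
ι-countL p [] = refl
ι-countL p (x ∷ xs) with p x
... | true = trans (ιn-+ 1 (countL p xs)) (cong (λ z → 1ℚ + z) (ι-countL p xs))
... | false = trans (ι-countL p xs) (≡-sym (ℚP.+-identityˡ _))

neg≡-1* : ∀ q → - q ≡ -1ℚ * q
neg≡-1* q = trans (cong -_ (≡-sym (ℚP.*-identityˡ q))) (ℚP.neg-distribˡ-* 1ℚ q)

ι-neg1^-countL : {A : Set} (p : A → Bool) (xs : List A) →
  ι (neg1^ (countL p xs)) ≡ ΠL xs (λ x → if p x then -1ℚ else 1ℚ)
ι-neg1^-countL p [] = refl
ι-neg1^-countL p (x ∷ xs) with p x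
... | true = trans (ι-neg (neg1^ (countL p xs)))
                   (trans (neg≡-1* _) (cong (-1ℚ *_) (ι-neg1^-countL p xs)))
... | false = trans (ι-neg1^-countL p xs) (≡-sym (ℚP.*-identityˡ _))

Expressible : ℕ → (Graph → ℚ) → Set
Expressible K F = ∃[ 𝒥 ] (All (λ p → n (proj₁ p) ≤ K) 𝒥 × ((G : Graph) → F G ≡ rhs 𝒥 G))

rhs-++ : (𝒥₁ 𝒥₂ : List (Graph × ℚ)) (G : Graph) → rhs (𝒥₁ List.++ 𝒥₂) G ≡ rhs 𝒥₁ G + rhs 𝒥₂ G
rhs-++ [] 𝒥₂ G = ≡-sym (ℚP.+-identityˡ _)
rhs-++ ((J , m) ∷ 𝒥₁) 𝒥₂ G =
  trans (cong (λ z → m * ι (jj J G) + z) (rhs-++ 𝒥₁ 𝒥₂ G)) (≡-sym (ℚP.+-assoc (m * ι (jj J G)) _ _))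

scaleCoeff : ℚ → Graph × ℚ → Graph × ℚ
scaleCoeff c (J , m) = J , c * m

rhs-scale : (c : ℚ) (𝒥 : List (Graph × ℚ)) (G : Graph) → rhs (List.map (scaleCoeff c) 𝒥) G ≡ c * rhs 𝒥 G
rhs-scale c [] G = ≡-sym (ℚP.*-zeroʳ c)
rhs-scale c ((J , m) ∷ 𝒥) G = begin
  c * m * ι (jj J G) + rhs (List.map (scaleCoeff c) 𝒥) G ≡⟨ cong₂ _+_ (ℚP.*-assoc c m _) (rhs-scale c 𝒥 G) ⟩
  c * (m * ι (jj J G)) + c * rhs 𝒥 G                     ≡⟨ ≡-sym (ℚP.*-distribˡ-+ c _ _) ⟩
  c * (m * ι (jj J G) + rhs 𝒥 G)                         ∎

expressible-0 : ∀ K → Expressible K (λ _ → 0ℚ)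
expressible-0 K = [] , All.[] , λ _ → refl

expressible-+ : ∀ {K F F'} → Expressible K F → Expressible K F' → Expressible K (λ G → F G + F' G)
expressible-+ (𝒥₁ , small₁ , eq₁) (𝒥₂ , small₂ , eq₂) =
  𝒥₁ List.++ 𝒥₂ , AllP.++⁺ small₁ small₂ , λ G → trans (cong₂ _+_ (eq₁ G) (eq₂ G)) (≡-sym (rhs-++ 𝒥₁ 𝒥₂ G))

expressible-scale : ∀ {K F} (c : ℚ) → Expressible K F → Expressible K (λ G → c * F G)
expressible-scale c (𝒥 , small , eq) =
  List.map (scaleCoeff c) 𝒥 , AllP.map⁺ small ,
  λ G → trans (cong (c *_) (eq G)) (≡-sym (rhs-scale c 𝒥 G))

expressible-ext : ∀ {K F F'} → (∀ G → F G ≡ F' G) → Expressible K F → Expressible K F'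
expressible-ext F≗F' (𝒥 , small , eq) = 𝒥 , small , λ G → trans (≡-sym (F≗F' G)) (eq G)

expressible-mono : ∀ {K K' F} → K ≤ K' → Expressible K F → Expressible K' F
expressible-mono K≤K' (𝒥 , small , eq) = 𝒥 , All.map (λ h → NatP.≤-trans h K≤K') small , eq

expressible-ΣL : ∀ {K} {A : Set} (xs : List A) (F : A → Graph → ℚ) →
  (∀ x → Expressible K (F x)) → Expressible K (λ G → ΣL xs (λ x → F x G))
expressible-ΣL [] F h = expressible-0 _
expressible-ΣL (x ∷ xs) F h = expressible-+ (h x) (expressible-ΣL xs F h)

expressible-jj : (J : Graph) → Expressible (n J) (λ G → ι (jj J G))
expressible-jj J =
  (J , 1ℚ) ∷ [] , NatP.≤-refl All.∷ All.[] , λ G → ≡-sym (trans (ℚP.+-identityʳ _) (ℚP.*-identityˡ _))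

allV : (G : Graph) (m : ℕ) → List (Vec (Fin (n G)) m)
allV G m = allVecs (Fin (n G)) (allFin (n G)) m

Pat : ℕ → Set
Pat m = Vec (Vec (Bool × Bool) m) m

pat : (G : Graph) {m : ℕ} → Vec (Fin (n G)) m → Pat m
pat G ψ = tabulate λ a → tabulate λ b → (lookup ψ a =ᶠ lookup ψ b , adj G (lookup ψ a) (lookup ψ b))

lookup²-tabulate : ∀ {A : Set} {m} (f : Fin m → Fin m → A) a b →
  lookup (lookup (tabulate λ a → tabulate λ b → f a b) a) b ≡ f a b
lookup²-tabulate f a b = trans (cong (λ row → lookup row b) (VecP.lookup∘tabulate _ a)) (VecP.lookup∘tabulate _ b)

restrictPat : {k m : ℕ} → (Fin k → Fin m) → Pat m → Pat k
restrictPat ρ P = tabulate λ a → tabulate λ b → lookup (lookup P (ρ a)) (ρ b)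

pat-restrict : (G : Graph) {k m : ℕ} (ψ' : Vec (Fin (n G)) k) (ψ : Vec (Fin (n G)) m) (ρ : Fin k → Fin m) →
  (∀ a → lookup ψ' a ≡ lookup ψ (ρ a)) → pat G ψ' ≡ restrictPat ρ (pat G ψ)
pat-restrict G ψ' ψ ρ ψ'≗ψ∘ρ = VecP.tabulate-cong λ a → VecP.tabulate-cong λ b →
  trans (cong₂ (λ u w → (u =ᶠ w , adj G u w)) (ψ'≗ψ∘ρ a) (ψ'≗ψ∘ρ b))
        (≡-sym (lookup²-tabulate _ (ρ a) (ρ b)))

Inj : ∀ {k m} → Vec (Fin k) m → Set
Inj φ = ∀ a b → lookup φ a ≡ lookup φ b → a ≡ b

injective⇒Inj : ∀ {k m} (φ : Vec (Fin k) m) → injective φ ≡ true → Inj φ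
injective⇒Inj φ e a b φa≡φb = distinct-or-equal (allB-true _ (allB-true _ e a) b)
  where
  distinct-or-equal : (a =ᶠ b ∨ not (lookup φ a =ᶠ lookup φ b)) ≡ true → a ≡ b
  distinct-or-equal h with a Fin.≟ b
  ... | yes a≡b = a≡b
  ... | no _ rewrite φa≡φb | =ᶠ-refl (lookup φ b) = ⊥-elim (BoolP.not-¬ refl h)

Inj⇒injective : ∀ {k m} (φ : Vec (Fin k) m) → Inj φ → injective φ ≡ true
Inj⇒injective φ inj = allB-intro _ λ a → allB-intro _ λ b → distinct-or-equal a b
  where
  distinct-or-equal : ∀ a b → (a =ᶠ b ∨ not (lookup φ a =ᶠ lookup φ b)) ≡ true
  distinct-or-equal a b with a Fin.≟ b
  ... | yes _ = refl
  ... | no a≢b with lookup φ a Fin.≟ lookup φ b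
  ...   | yes φa≡φb = ⊥-elim (a≢b (inj a b φa≡φb))
  ...   | no _ = refl

memb : ∀ {k m} → Fin k → Vec (Fin k) m → Bool
memb {m = m} x φ = anyL (λ c → lookup φ c =ᶠ x) (allFin m)

memb⇒∃ : ∀ {k m} (x : Fin k) (φ : Vec (Fin k) m) → memb x φ ≡ true → ∃ λ c → lookup φ c ≡ x
memb⇒∃ {m = m} x φ e = let (c , _ , φc=x) = anyL-true (λ c → lookup φ c =ᶠ x) (allFin m) e in c , =ᶠ-true φc=x

∃⇒memb : ∀ {k m} (x : Fin k) (φ : Vec (Fin k) m) c → lookup φ c ≡ x → memb x φ ≡ true
∃⇒memb {m = m} x φ c φc≡x =
  anyL-intro (λ c → lookup φ c =ᶠ x) (allFin m) c (∈-allFin c) (trans (cong (_=ᶠ x) φc≡x) (=ᶠ-refl x))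

injective-∷ : ∀ {k m} (x : Fin k) (φ : Vec (Fin k) m) → injective (x ∷ φ) ≡ not (memb x φ) ∧ injective φ
injective-∷ x φ = bool-ext to from
  where
  to : injective (x ∷ φ) ≡ true → not (memb x φ) ∧ injective φ ≡ true
  to e with memb x φ in x∈φ
  ... | true = let (c , φc≡x) = memb⇒∃ x φ x∈φ in
               ⊥-elim (FinP.0≢1+n (injective⇒Inj (x ∷ φ) e zero (suc c) (≡-sym φc≡x)))
  ... | false = Inj⇒injective φ (λ a b eq → FinP.suc-injective (injective⇒Inj (x ∷ φ) e (suc a) (suc b) eq))
  from : not (memb x φ) ∧ injective φ ≡ true → injective (x ∷ φ) ≡ true
  from e = let (x∉φ , injφ) = ∧-true {not (memb x φ)} e in
           Inj⇒injective (x ∷ φ) (inj-∷ (not-true x∉φ) (injective⇒Inj φ injφ))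
    where
    inj-∷ : memb x φ ≡ false → Inj φ → Inj (x ∷ φ)
    inj-∷ x∉φ inj zero zero _ = refl
    inj-∷ x∉φ inj zero (suc b) eq = ⊥-elim (false≢true x∉φ (∃⇒memb x φ b (≡-sym eq)))
    inj-∷ x∉φ inj (suc a) zero eq = ⊥-elim (false≢true x∉φ (∃⇒memb x φ a eq))
    inj-∷ x∉φ inj (suc a) (suc b) eq = cong suc (inj a b eq)

-- An injective φ hits x at most once, so the number of hits is [x ∈ φ].
ΣFin-hits : ∀ {k m} (x : Fin k) (φ : Vec (Fin k) m) → injective φ ≡ true →
  ΣL (allFin m) (λ c → [ lookup φ c =ᶠ x ]) ≡ [ memb x φ ]
ΣFin-hits x [] _ = refl
ΣFin-hits {m = ℕ.suc m} x (y ∷ φ) e = begin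
  ΣL (allFin (ℕ.suc m)) (λ c → [ lookup (y ∷ φ) c =ᶠ x ])
    ≡⟨ ΣFin-suc m (λ c → [ lookup (y ∷ φ) c =ᶠ x ]) ⟩
  [ y =ᶠ x ] + ΣL (allFin m) (λ c → [ lookup φ c =ᶠ x ])
    ≡⟨ cong (λ z → [ y =ᶠ x ] + z) (ΣFin-hits x φ injφ) ⟩
  [ y =ᶠ x ] + [ memb x φ ]
    ≡⟨ disjoint-[∨] (y =ᶠ x) (memb x φ) (λ y=x → subst (λ z → memb z φ ≡ false) (=ᶠ-true y=x) y∉φ) ⟩
  [ (y =ᶠ x) ∨ memb x φ ]
    ≡⟨ ≡-sym (cong [_] (anyL-suc m (λ c → lookup (y ∷ φ) c =ᶠ x))) ⟩
  [ memb x (y ∷ φ) ] ∎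
  where
  y∉φ,injφ : not (memb y φ) ≡ true × injective φ ≡ true
  y∉φ,injφ = ∧-true {not (memb y φ)} (trans (≡-sym (injective-∷ y φ)) e)
  y∉φ : memb y φ ≡ false
  y∉φ = not-true (proj₁ y∉φ,injφ)
  injφ : injective φ ≡ true
  injφ = proj₂ y∉φ,injφ
  disjoint-[∨] : ∀ b c → (b ≡ true → c ≡ false) → [ b ] + [ c ] ≡ [ b ∨ c ]
  disjoint-[∨] true c b⇒¬c rewrite b⇒¬c refl = ℚP.+-identityʳ 1ℚ
  disjoint-[∨] false c _ = ℚP.+-identityˡ [ c ]

ΣFin-split-image : ∀ {N r} (φ : Vec (Fin N) r) → injective φ ≡ true → (f : Fin N → ℚ) →
  ΣL (allFin N) f ≡ ΣL (allFin N) (λ x → [ not (memb x φ) ] * f x) + ΣL (allFin r) (λ c → f (lookup φ c))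
ΣFin-split-image {N} {r} φ injφ f = begin
  ΣL (allFin N) f
    ≡⟨ ΣL-cong (allFin N) (λ x → split (memb x φ) (f x)) ⟩
  ΣL (allFin N) (λ x → [ not (memb x φ) ] * f x + [ memb x φ ] * f x)
    ≡⟨ ΣL-+ (allFin N) _ _ ⟩
  ΣL (allFin N) (λ x → [ not (memb x φ) ] * f x) + ΣL (allFin N) (λ x → [ memb x φ ] * f x)
    ≡⟨ cong (λ z → ΣL (allFin N) (λ x → [ not (memb x φ) ] * f x) + z) image ⟩
  ΣL (allFin N) (λ x → [ not (memb x φ) ] * f x) + ΣL (allFin r) (λ c → f (lookup φ c)) ∎
  where
  split : ∀ b q → q ≡ [ not b ] * q + [ b ] * q
  split true q = ≡-sym (trans (cong (_+ (1ℚ * q)) (ℚP.*-zeroˡ q)) (trans (ℚP.+-identityˡ _) (ℚP.*-identityˡ q)))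
  split false q = ≡-sym (trans (cong (λ z → 1ℚ * q + z) (ℚP.*-zeroˡ q)) (trans (ℚP.+-identityʳ _) (ℚP.*-identityˡ q)))
  image : ΣL (allFin N) (λ x → [ memb x φ ] * f x) ≡ ΣL (allFin r) (λ c → f (lookup φ c))
  image = begin
    ΣL (allFin N) (λ x → [ memb x φ ] * f x)
      ≡⟨ ΣL-cong (allFin N) (λ x → trans (cong (_* f x) (≡-sym (ΣFin-hits x φ injφ))) (ΣL-*ʳ (f x) (allFin r) _)) ⟩
    ΣL (allFin N) (λ x → ΣL (allFin r) (λ c → [ lookup φ c =ᶠ x ] * f x))
      ≡⟨ ΣL-swap (allFin N) (allFin r) _ ⟩
    ΣL (allFin r) (λ c → ΣL (allFin N) (λ x → [ lookup φ c =ᶠ x ] * f x))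
      ≡⟨ ΣL-cong (allFin r) (λ c → trans (ΣL-cong (allFin N) (λ x → cong (λ b → [ b ] * f x) (=ᶠ-sym (lookup φ c) x)))
                                         (ΣFin-δ N (lookup φ c) f)) ⟩
    ΣL (allFin r) (λ c → f (lookup φ c)) ∎

-- Extending a tuple φ by a vertex x: either x ∷ φ is injective, or x is one
-- of the entries of φ.  Weighted by [φ injective], this is an identity.
injective-extend : ∀ {N r} (φ : Vec (Fin N) r) (f : Fin N → ℚ) →
  [ injective φ ] * ΣL (allFin N) f ≡
  ΣL (allFin N) (λ x → [ injective (x ∷ φ) ] * f x) + ΣL (allFin r) (λ c → [ injective φ ] * f (lookup φ c))
injective-extend {N} {r} φ f with injective φ in injφ
... | true = begin
  1ℚ * ΣL (allFin N) f
    ≡⟨ ℚP.*-identityˡ _ ⟩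
  ΣL (allFin N) f
    ≡⟨ ΣFin-split-image φ injφ f ⟩
  ΣL (allFin N) (λ x → [ not (memb x φ) ] * f x) + ΣL (allFin r) (λ c → f (lookup φ c))
    ≡⟨ cong₂ _+_ (ΣL-cong (allFin N) (λ x → cong (λ b → [ b ] * f x) (≡-sym (fresh x))))
                 (ΣL-cong (allFin r) (λ c → ≡-sym (ℚP.*-identityˡ _))) ⟩
  ΣL (allFin N) (λ x → [ injective (x ∷ φ) ] * f x) + ΣL (allFin r) (λ c → 1ℚ * f (lookup φ c)) ∎
  where
  fresh : ∀ x → injective (x ∷ φ) ≡ not (memb x φ)
  fresh x = trans (injective-∷ x φ) (trans (cong (not (memb x φ) ∧_) injφ) (BoolP.∧-identityʳ _))
... | false = begin
  0ℚ * ΣL (allFin N) f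
    ≡⟨ ℚP.*-zeroˡ (ΣL (allFin N) f) ⟩
  0ℚ
    ≡⟨ ≡-sym (cong₂ _+_ (trans (ΣL-cong (allFin N) (λ x → trans (cong (λ b → [ b ] * f x) (stale x)) (ℚP.*-zeroˡ (f x))))
                               (ΣL-0 (allFin N)))
                        (trans (ΣL-cong (allFin r) (λ c → ℚP.*-zeroˡ (f (lookup φ c)))) (ΣL-0 (allFin r)))) ⟩
  ΣL (allFin N) (λ x → [ injective (x ∷ φ) ] * f x) + ΣL (allFin r) (λ c → 0ℚ * f (lookup φ c)) ∎
  where
  stale : ∀ x → injective (x ∷ φ) ≡ false
  stale x = trans (injective-∷ x φ) (trans (cong (not (memb x φ) ∧_) injφ) (BoolP.∧-zeroʳ _))

-- With the characters
--   char f u = χ(u)^f ,  dualChar f w = ½ χ(w)^f   (χ true = 1, χ false = -1)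
-- the Kronecker delta on Bool is  [w = u] = Σ_f dualChar f w · char f u ;
-- taking entrywise products expands the delta on r×r Boolean matrices, and
-- hence every function of a matrix, in the characters  Π_{a,b} char.

χ : Bool → ℚ
χ true = 1ℚ
χ false = -1ℚ

½ : ℚ
½ = + 1 / 2

char : Bool → Bool → ℚ
char f u = if f then χ u else 1ℚ

dualChar : Bool → Bool → ℚ
dualChar f w = if f then ½ * χ w else ½

boolδ-fourier : ∀ w u → [ w =ᵇ u ] ≡ ΣL bools (λ f → dualChar f w * char f u)
boolδ-fourier true true = refl
boolδ-fourier true false = refl
boolδ-fourier false true = refl
boolδ-fourier false false = refl

prodVec : {F A : Set} (S : F → A → ℚ) {m : ℕ} → Vec F m → Vec A m → ℚ
prodVec S [] [] = 1ℚ
prodVec S (f ∷ fs) (w ∷ ws) = S f w * prodVec S fs ws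

prodVec-ΠL : {F A : Set} (S : F → A → ℚ) {m : ℕ} (fs : Vec F m) (ws : Vec A m) →
  prodVec S fs ws ≡ ΠL (allFin m) (λ i → S (lookup fs i) (lookup ws i))
prodVec-ΠL S [] [] = refl
prodVec-ΠL S {ℕ.suc m} (f ∷ fs) (w ∷ ws) =
  trans (cong (S f w *_) (prodVec-ΠL S fs ws)) (≡-sym (ΠFin-suc m (λ i → S (lookup (f ∷ fs) i) (lookup (w ∷ ws) i))))

δVec-fourier : {F A : Set} (Y : List F) (S₁ S₂ : F → A → ℚ) (D : A → A → ℚ) →
  (∀ w u → D w u ≡ ΣL Y (λ f → S₁ f w * S₂ f u)) →
  ∀ m (ws us : Vec A m) → δVec D ws us ≡ ΣL (allVecs F Y m) (λ fs → prodVec S₁ fs ws * prodVec S₂ fs us)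
δVec-fourier Y S₁ S₂ D D≡ ℕ.zero [] [] = ≡-sym (ℚP.+-identityʳ _)
δVec-fourier Y S₁ S₂ D D≡ (ℕ.suc m) (w ∷ ws) (u ∷ us) = begin
  D w u * δVec D ws us
    ≡⟨ cong₂ _*_ (D≡ w u) (δVec-fourier Y S₁ S₂ D D≡ m ws us) ⟩
  ΣL Y (λ f → S₁ f w * S₂ f u) * ΣL Ys (λ fs → P₁ fs * P₂ fs)
    ≡⟨ ΣL-*ʳ _ Y _ ⟩
  ΣL Y (λ f → S₁ f w * S₂ f u * ΣL Ys (λ fs → P₁ fs * P₂ fs))
    ≡⟨ ΣL-cong Y (λ f → trans (ΣL-*ˡ (S₁ f w * S₂ f u) Ys _)
                              (ΣL-cong Ys (λ fs → *-interchange (S₁ f w) (S₂ f u) (P₁ fs) (P₂ fs)))) ⟩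
  ΣL Y (λ f → ΣL Ys (λ fs → (S₁ f w * P₁ fs) * (S₂ f u * P₂ fs)))
    ≡⟨ ≡-sym (ΣVec-suc Y m (λ fs → prodVec S₁ fs (w ∷ ws) * prodVec S₂ fs (u ∷ us))) ⟩
  ΣL (allVecs _ Y (ℕ.suc m)) (λ fs → prodVec S₁ fs (w ∷ ws) * prodVec S₂ fs (u ∷ us)) ∎
  where
  Ys : List (Vec _ m)
  Ys = allVecs _ Y m
  P₁ P₂ : Vec _ m → ℚ
  P₁ fs = prodVec S₁ fs ws
  P₂ fs = prodVec S₂ fs us

Mat : ℕ → Set
Mat r = Vec (Vec Bool r) r

entry : ∀ {r} → Mat r → Fin r → Fin r → Bool
entry M a b = lookup (lookup M a) b

allMat : ∀ r → List (Mat r)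
allMat r = allVecs (Vec Bool r) (allVecs Bool bools r) r

matδ : ∀ {r} → Mat r → Mat r → ℚ
matδ = δVec (δVec (λ w u → [ w =ᵇ u ]))

matδ-isDelta : ∀ r → IsDelta (allMat r) matδ
matδ-isDelta r = δVec-isDelta _ _ (δVec-isDelta bools _ boolδ-isDelta r) r

charMat dualCharMat : ∀ {r} → Mat r → Mat r → ℚ
charMat = prodVec (prodVec char)
dualCharMat = prodVec (prodVec dualChar)

matδ-fourier : ∀ r (W U : Mat r) → matδ W U ≡ ΣL (allMat r) (λ F → dualCharMat F W * charMat F U)
matδ-fourier r = δVec-fourier (allVecs Bool bools r) (prodVec dualChar) (prodVec char) _
                   (δVec-fourier bools dualChar char _ boolδ-fourier r) r

fourierCoeff : ∀ {r} → (Mat r → ℚ) → Mat r → ℚ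
fourierCoeff {r} h F = ΣL (allMat r) (λ W → h W * dualCharMat F W)

fourier-expansion : ∀ r (h : Mat r → ℚ) (U : Mat r) →
  h U ≡ ΣL (allMat r) (λ F → fourierCoeff h F * charMat F U)
fourier-expansion r h U = begin
  h U
    ≡⟨ ≡-sym (matδ-isDelta r h U) ⟩
  ΣL Ms (λ W → h W * matδ W U)
    ≡⟨ ΣL-cong Ms (λ W → trans (cong (h W *_) (matδ-fourier r W U)) (ΣL-*ˡ (h W) Ms _)) ⟩
  ΣL Ms (λ W → ΣL Ms (λ F → h W * (dualCharMat F W * charMat F U)))
    ≡⟨ ΣL-swap Ms Ms _ ⟩
  ΣL Ms (λ F → ΣL Ms (λ W → h W * (dualCharMat F W * charMat F U)))
    ≡⟨ ΣL-cong Ms (λ F → trans (ΣL-cong Ms (λ W → ≡-sym (ℚP.*-assoc (h W) _ _)))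
                               (≡-sym (ΣL-*ʳ (charMat F U) Ms _))) ⟩
  ΣL Ms (λ F → fourierCoeff h F * charMat F U) ∎
  where
  Ms : List (Mat r)
  Ms = allMat r

ΠΠ : ∀ {r} → (Fin r → Fin r → ℚ) → ℚ
ΠΠ {r} f = ΠL (allFin r) (λ a → ΠL (allFin r) (λ b → f a b))

ΠΠ-cong : ∀ {r} {f g : Fin r → Fin r → ℚ} → (∀ a b → f a b ≡ g a b) → ΠΠ f ≡ ΠΠ g
ΠΠ-cong {r} e = ΠL-cong (allFin r) (λ a → ΠL-cong (allFin r) (e a))

ΠΠ-* : ∀ {r} (f g : Fin r → Fin r → ℚ) → ΠΠ (λ a b → f a b * g a b) ≡ ΠΠ f * ΠΠ g
ΠΠ-* {r} f g = trans (ΠL-cong (allFin r) (λ a → ΠL-* (allFin r) (f a) (g a))) (ΠL-* (allFin r) _ _)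

ΠΠ-transpose : ∀ {r} (f : Fin r → Fin r → ℚ) → ΠΠ f ≡ ΠΠ (λ a b → f b a)
ΠΠ-transpose {r} f = ΠL-swap (allFin r) (allFin r) f

ΠL-pairs : ∀ r (f : Fin r × Fin r → ℚ) →
  ΠL (concatMap (λ a → List.map (a ,_) (allFin r)) (allFin r)) f ≡ ΠΠ (λ a b → f (a , b))
ΠL-pairs r f = trans (ΠL-concatMap _ (allFin r) f) (ΠL-cong (allFin r) (λ a → ΠL-map (a ,_) (allFin r) f))

charMat-ΠΠ : ∀ {r} (F U : Mat r) → charMat F U ≡ ΠΠ (λ a b → char (entry F a b) (entry U a b))
charMat-ΠΠ {r} F U = trans (prodVec-ΠL (prodVec char) F U) (ΠL-cong (allFin r) (λ a → prodVec-ΠL char (lookup F a) (lookup U a)))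

xorAdj : ∀ {r} → (Fin r → Fin r → Bool) → Fin r → Fin r → Bool
xorAdj F a b = if a =ᶠ b then false else (F a b xor F b a)

graphOf : ∀ {r} → Mat r → Graph
graphOf {r} F = record { n = r ; adj = xorAdj (entry F) ; sym = symmetric ; irref = irreflexive }
  where
  symmetric : ∀ a b → xorAdj (entry F) a b ≡ xorAdj (entry F) b a
  symmetric a b rewrite =ᶠ-sym a b with b =ᶠ a
  ... | true = refl
  ... | false = BoolP.xor-comm (entry F a b) (entry F b a)
  irreflexive : ∀ a → xorAdj (entry F) a a ≡ false
  irreflexive a rewrite =ᶠ-refl a = refl

diagSign : ∀ {r} → (Fin r → Fin r → Bool) → ℚ
diagSign F = ΠΠ (λ a b → if (a =ᶠ b) ∧ F a b then -1ℚ else 1ℚ)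

_<ᵇ_ : ∀ {r} → Fin r → Fin r → Bool
a <ᵇ b = isYes (toℕ a Nat.<? toℕ b)

<ᵇ-true : ∀ {r} {a b : Fin r} → toℕ a Nat.< toℕ b → (a <ᵇ b) ≡ true
<ᵇ-true {a = a} {b} p with toℕ a Nat.<? toℕ b
... | yes _ = refl
... | no ¬p = ⊥-elim (¬p p)

<ᵇ-false : ∀ {r} {a b : Fin r} → ¬ (toℕ a Nat.< toℕ b) → (a <ᵇ b) ≡ false
<ᵇ-false {a = a} {b} ¬p with toℕ a Nat.<? toℕ b
... | yes p = ⊥-elim (¬p p)
... | no _ = refl

data Trichotomy : Bool → Bool → Bool → Set where
  less    : Trichotomy true false false
  equal   : Trichotomy false true false
  greater : Trichotomy false false true

trichotomy : ∀ {r} (a b : Fin r) → Trichotomy (a <ᵇ b) (a =ᶠ b) (b <ᵇ a)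
trichotomy a b with FinP.<-cmp a b
... | tri< a<b a≢b b≮a rewrite <ᵇ-true {a = a} {b} a<b | =ᶠ-false a≢b | <ᵇ-false {a = b} {a} b≮a = less
... | tri≈ a≮a refl _ rewrite <ᵇ-false {a = a} {a} a≮a | =ᶠ-refl a = equal
... | tri> a≮b a≢b b<a rewrite <ᵇ-false {a = a} {b} a≮b | =ᶠ-false a≢b | <ᵇ-true {a = b} {a} b<a = greater

-- For a symmetric irreflexive relation u, the product of
-- char (F a b) (u a b) over all ordered pairs is the diagonal sign of F times
-- (-1) to the number of pairs a < b that are edges of J_F but not of u: the
-- diagonal contributes χ(false)^(F a a), and the two factors of a pair a < b
-- multiply to -1 exactly when F a b ≠ F b a and u a b fails.
ΠΠ-char : ∀ {r} (F u : Fin r → Fin r → Bool) → (∀ a b → u a b ≡ u b a) → (∀ a → u a a ≡ false) →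
  ΠΠ (λ a b → char (F a b) (u a b)) ≡
  diagSign F * ΠΠ (λ a b → if (a <ᵇ b) ∧ xorAdj F a b ∧ not (u a b) then -1ℚ else 1ℚ)
ΠΠ-char {r} F u u-sym u-irrefl = begin
  ΠΠ g
    ≡⟨ ΠΠ-cong (λ a b → split-by-position (trichotomy a b) (g a b)) ⟩
  ΠΠ (λ a b → (above a b * diagonal a b) * below a b)
    ≡⟨ ΠΠ-* (λ a b → above a b * diagonal a b) below ⟩
  ΠΠ (λ a b → above a b * diagonal a b) * ΠΠ below
    ≡⟨ cong₂ _*_ (ΠΠ-* above diagonal) (ΠΠ-transpose below) ⟩
  (ΠΠ above * ΠΠ diagonal) * ΠΠ (λ a b → below b a)
    ≡⟨ rearrange (ΠΠ above) (ΠΠ diagonal) (ΠΠ (λ a b → below b a)) ⟩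
  ΠΠ diagonal * (ΠΠ above * ΠΠ (λ a b → below b a))
    ≡⟨ cong₂ _*_ (ΠΠ-cong diagonal-sign) (trans (≡-sym (ΠΠ-* above (λ a b → below b a))) (ΠΠ-cong pair-sign)) ⟩
  diagSign F * ΠΠ (λ a b → if (a <ᵇ b) ∧ xorAdj F a b ∧ not (u a b) then -1ℚ else 1ℚ) ∎
  where
  g above diagonal below : Fin r → Fin r → ℚ
  g a b = char (F a b) (u a b)
  above a b = if a <ᵇ b then g a b else 1ℚ
  diagonal a b = if a =ᶠ b then g a b else 1ℚ
  below a b = if b <ᵇ a then g a b else 1ℚ

  split-by-position : ∀ {x y z} → Trichotomy x y z → ∀ q →
    q ≡ ((if x then q else 1ℚ) * (if y then q else 1ℚ)) * (if z then q else 1ℚ)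
  split-by-position less q = ≡-sym (trans (ℚP.*-identityʳ _) (ℚP.*-identityʳ q))
  split-by-position equal q = ≡-sym (trans (ℚP.*-identityʳ _) (ℚP.*-identityˡ q))
  split-by-position greater q = ≡-sym (trans (cong (_* q) (ℚP.*-identityˡ 1ℚ)) (ℚP.*-identityˡ q))

  rearrange : ∀ x y z → (x * y) * z ≡ y * (x * z)
  rearrange = solve 3 (λ x y z → (x :* y) :* z := y :* (x :* z)) refl
    where open +-*-Solver

  diagonal-sign : ∀ a b → diagonal a b ≡ (if (a =ᶠ b) ∧ F a b then -1ℚ else 1ℚ)
  diagonal-sign a b with a =ᶠ b in a=b
  ... | false = refl
  ... | true with =ᶠ-true a=b
  ...   | refl rewrite u-irrefl a with F a a
  ...     | true = refl
  ...     | false = refl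

  char-pair : ∀ x y w → char x w * char y w ≡ (if (x xor y) ∧ not w then -1ℚ else 1ℚ)
  char-pair true true true = refl
  char-pair true true false = refl
  char-pair true false true = refl
  char-pair true false false = refl
  char-pair false true true = refl
  char-pair false true false = refl
  char-pair false false true = refl
  char-pair false false false = refl

  pair-sign : ∀ a b → above a b * below b a ≡ (if (a <ᵇ b) ∧ xorAdj F a b ∧ not (u a b) then -1ℚ else 1ℚ)
  pair-sign a b rewrite u-sym b a with a <ᵇ b | a =ᶠ b | b <ᵇ a | trichotomy a b
  ... | .true | .false | .false | less = char-pair (F a b) (F b a) (u a b)
  ... | .false | .true | .false | equal = refl
  ... | .false | .false | .true | greater = refl

adjMat : (G : Graph) {r : ℕ} → Vec (Fin (n G)) r → Mat r
adjMat G φ = tabulate λ a → tabulate λ b → adj G (lookup φ a) (lookup φ b)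

charMat-adjMat : (G : Graph) {r : ℕ} (F : Mat r) (φ : Vec (Fin (n G)) r) →
  charMat F (adjMat G φ) ≡ diagSign (entry F) * ι (neg1^ (badEdges (graphOf F) G φ))
charMat-adjMat G {r} F φ = begin
  charMat F (adjMat G φ)
    ≡⟨ charMat-ΠΠ F (adjMat G φ) ⟩
  ΠΠ (λ a b → char (entry F a b) (entry (adjMat G φ) a b))
    ≡⟨ ΠΠ-cong (λ a b → cong (char (entry F a b)) (lookup²-tabulate u a b)) ⟩
  ΠΠ (λ a b → char (entry F a b) (u a b))
    ≡⟨ ΠΠ-char (entry F) u (λ a b → Graph.sym G (lookup φ a) (lookup φ b)) (λ a → irref G (lookup φ a)) ⟩
  diagSign (entry F) * ΠΠ (λ a b → sign (a , b))
    ≡⟨ cong (diagSign (entry F) *_) (≡-sym (trans (ι-neg1^-countL bad pairs) (ΠL-pairs r sign))) ⟩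
  diagSign (entry F) * ι (neg1^ (badEdges (graphOf F) G φ)) ∎
  where
  u : Fin r → Fin r → Bool
  u a b = adj G (lookup φ a) (lookup φ b)
  pairs : List (Fin r × Fin r)
  pairs = concatMap (λ a → List.map (a ,_) (allFin r)) (allFin r)
  bad : Fin r × Fin r → Bool
  bad (a , b) = (a <ᵇ b) ∧ xorAdj (entry F) a b ∧ not (u a b)
  sign : Fin r × Fin r → ℚ
  sign ab = if bad ab then -1ℚ else 1ℚ

jj-expand : (J G : Graph) → ι (jj J G) ≡ ΣL (allV G (n J)) (λ φ → [ injective φ ] * ι (neg1^ (badEdges J G φ)))
jj-expand J G = trans (ι-sumℤ (λ φ → neg1^ (badEdges J G φ)) (filterᵇ injective (allV G (n J))))
                      (ΣL-filter injective (allV G (n J)) (λ φ → ι (neg1^ (badEdges J G φ))))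

mkPat : ∀ {r} → Mat r → Pat r
mkPat U = tabulate λ a → tabulate λ b → (a =ᶠ b , entry U a b)

pat-injective : (G : Graph) {r : ℕ} (φ : Vec (Fin (n G)) r) → injective φ ≡ true → pat G φ ≡ mkPat (adjMat G φ)
pat-injective G φ injφ = VecP.tabulate-cong λ a → VecP.tabulate-cong λ b →
  cong₂ _,_ (bool-ext (λ φa=φb → trans (cong (_=ᶠ b) (injective⇒Inj φ injφ a b (=ᶠ-true φa=φb))) (=ᶠ-refl b))
                      (λ a=b → trans (cong (λ z → lookup φ a =ᶠ lookup φ z) (≡-sym (=ᶠ-true a=b))) (=ᶠ-refl (lookup φ a))))
            (≡-sym (lookup²-tabulate (λ a b → adj G (lookup φ a) (lookup φ b)) a b))

-- (A) for injective tuples: by the Fourier expansion of h ∘ mkPat, the sum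
-- is Σ_F coefficient(F) · j(J_F, G).
injectivePatternSum-expressible : ∀ r (h : Pat r → ℚ) →
  Expressible r (λ G → ΣL (allV G r) (λ φ → [ injective φ ] * h (pat G φ)))
injectivePatternSum-expressible r h =
  expressible-ext (λ G → ≡-sym (expansion G))
    (expressible-ΣL (allMat r) (λ F G → coeff F * ι (jj (graphOf F) G))
                    (λ F → expressible-scale (coeff F) (expressible-jj (graphOf F))))
  where
  h' : Mat r → ℚ
  h' U = h (mkPat U)
  coeff : Mat r → ℚ
  coeff F = fourierCoeff h' F * diagSign (entry F)
  on-injective : (G : Graph) (φ : Vec (Fin (n G)) r) → [ injective φ ] * h (pat G φ) ≡ [ injective φ ] * h' (adjMat G φ)
  on-injective G φ with injective φ in injφ
  ... | true = cong (λ P → 1ℚ * h P) (pat-injective G φ injφ)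
  ... | false = trans (ℚP.*-zeroˡ (h (pat G φ))) (≡-sym (ℚP.*-zeroˡ (h' (adjMat G φ))))
  reassoc : ∀ i c s x → i * (c * (s * x)) ≡ (c * s) * (i * x)
  reassoc = solve 4 (λ i c s x → i :* (c :* (s :* x)) := (c :* s) :* (i :* x)) refl
    where open +-*-Solver
  expansion : (G : Graph) →
    ΣL (allV G r) (λ φ → [ injective φ ] * h (pat G φ)) ≡ ΣL (allMat r) (λ F → coeff F * ι (jj (graphOf F) G))
  expansion G = begin
    ΣL Φ (λ φ → [ injective φ ] * h (pat G φ))
      ≡⟨ ΣL-cong Φ (on-injective G) ⟩
    ΣL Φ (λ φ → [ injective φ ] * h' (adjMat G φ))
      ≡⟨ ΣL-cong Φ expand ⟩
    ΣL Φ (λ φ → ΣL (allMat r) (λ F → [ injective φ ] * (fourierCoeff h' F * charMat F (adjMat G φ))))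
      ≡⟨ ΣL-swap Φ (allMat r) _ ⟩
    ΣL (allMat r) (λ F → ΣL Φ (λ φ → [ injective φ ] * (fourierCoeff h' F * charMat F (adjMat G φ))))
      ≡⟨ ΣL-cong (allMat r) per-matrix ⟩
    ΣL (allMat r) (λ F → coeff F * ι (jj (graphOf F) G)) ∎
    where
    Φ : List (Vec (Fin (n G)) r)
    Φ = allV G r
    expand : ∀ φ → [ injective φ ] * h' (adjMat G φ) ≡
             ΣL (allMat r) (λ F → [ injective φ ] * (fourierCoeff h' F * charMat F (adjMat G φ)))
    expand φ = trans (cong ([ injective φ ] *_) (fourier-expansion r h' (adjMat G φ))) (ΣL-*ˡ [ injective φ ] (allMat r) _)
    per-matrix : ∀ F → ΣL Φ (λ φ → [ injective φ ] * (fourierCoeff h' F * charMat F (adjMat G φ))) ≡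
                       coeff F * ι (jj (graphOf F) G)
    per-matrix F = begin
      ΣL Φ (λ φ → [ injective φ ] * (fourierCoeff h' F * charMat F (adjMat G φ)))
        ≡⟨ ΣL-cong Φ (λ φ → cong (λ z → [ injective φ ] * (fourierCoeff h' F * z)) (charMat-adjMat G F φ)) ⟩
      ΣL Φ (λ φ → [ injective φ ] * (fourierCoeff h' F * (diagSign (entry F) * ι (neg1^ (badEdges (graphOf F) G φ)))))
        ≡⟨ ΣL-cong Φ (λ φ → reassoc [ injective φ ] (fourierCoeff h' F) (diagSign (entry F)) _) ⟩
      ΣL Φ (λ φ → coeff F * ([ injective φ ] * ι (neg1^ (badEdges (graphOf F) G φ))))
        ≡⟨ ≡-sym (ΣL-*ˡ (coeff F) Φ _) ⟩
      coeff F * ΣL Φ (λ φ → [ injective φ ] * ι (neg1^ (badEdges (graphOf F) G φ)))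
        ≡⟨ cong (coeff F *_) (≡-sym (jj-expand (graphOf F) G)) ⟩
      coeff F * ι (jj (graphOf F) G) ∎

-- (A) for arbitrary tuples.  mixedSum m r g sums g over the patterns of
-- ψ ++ φ with ψ ∈ V^m arbitrary and φ ∈ V^r injective.  Induction on m: the
-- first free entry x is either fresh for φ (so it joins the injective part)
-- or equal to some entry φ c (so it can be dropped, remembering c in g).

mixedSum : ∀ m r → (Pat (m Nat.+ r) → ℚ) → Graph → ℚ
mixedSum m r g G = ΣL (allV G r) (λ φ → [ injective φ ] * ΣL (allV G m) (λ ψ → g (pat G (ψ ++ φ))))

moveFresh : ∀ m r → Fin (ℕ.suc (m Nat.+ r)) → Fin (m Nat.+ ℕ.suc r)
moveFresh m r zero = m ↑ʳ zero
moveFresh m r (suc a) = [ (λ i → i ↑ˡ ℕ.suc r) , (λ j → m ↑ʳ suc j) ]′ (Fin.splitAt m a)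

moveFresh-lookup : ∀ {A : Set} m r (x : A) (ψ : Vec A m) (φ : Vec A r) a →
  lookup (x ∷ (ψ ++ φ)) a ≡ lookup (ψ ++ (x ∷ φ)) (moveFresh m r a)
moveFresh-lookup m r x ψ φ zero = ≡-sym (VecP.lookup-++ʳ ψ (x ∷ φ) zero)
moveFresh-lookup {A} m r x ψ φ (suc a) = trans (VecP.lookup-splitAt m ψ φ a) (by-side (Fin.splitAt m a))
  where
  by-side : (s : Fin m ⊎ Fin r) → [ lookup ψ , lookup φ ]′ s ≡
            lookup (ψ ++ (x ∷ φ)) ([ (λ i → i ↑ˡ ℕ.suc r) , (λ j → m ↑ʳ suc j) ]′ s)
  by-side (inj₁ i) = ≡-sym (VecP.lookup-++ˡ ψ (x ∷ φ) i)
  by-side (inj₂ j) = ≡-sym (VecP.lookup-++ʳ ψ (x ∷ φ) (suc j))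

dropRepeat : ∀ m r → Fin r → Fin (ℕ.suc (m Nat.+ r)) → Fin (m Nat.+ r)
dropRepeat m r c zero = m ↑ʳ c
dropRepeat m r c (suc a) = a

dropRepeat-lookup : ∀ {A : Set} m r (ψ : Vec A m) (φ : Vec A r) c a →
  lookup (lookup φ c ∷ (ψ ++ φ)) a ≡ lookup (ψ ++ φ) (dropRepeat m r c a)
dropRepeat-lookup m r ψ φ c zero = ≡-sym (VecP.lookup-++ʳ ψ φ c)
dropRepeat-lookup m r ψ φ c (suc a) = refl

mixedSum-peel : ∀ m r (g : Pat (ℕ.suc m Nat.+ r) → ℚ) (G : Graph) →
  mixedSum (ℕ.suc m) r g G ≡
  mixedSum m (ℕ.suc r) (g ∘ restrictPat (moveFresh m r)) G +
  ΣL (allFin r) (λ c → mixedSum m r (g ∘ restrictPat (dropRepeat m r c)) G)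
mixedSum-peel m r g G = begin
  mixedSum (ℕ.suc m) r g G
    ≡⟨ ΣL-cong (allV G r) (λ φ → cong ([ injective φ ] *_) (ΣVec-suc V m (λ ψ → g (pat G (ψ ++ φ))))) ⟩
  ΣL (allV G r) (λ φ → [ injective φ ] * ΣL V (k φ))
    ≡⟨ ΣL-cong (allV G r) (λ φ → injective-extend φ (k φ)) ⟩
  ΣL (allV G r) (λ φ → ΣL V (λ x → [ injective (x ∷ φ) ] * k φ x) + ΣL (allFin r) (λ c → [ injective φ ] * k φ (lookup φ c)))
    ≡⟨ ΣL-+ (allV G r) _ _ ⟩
  ΣL (allV G r) (λ φ → ΣL V (λ x → [ injective (x ∷ φ) ] * k φ x)) +
  ΣL (allV G r) (λ φ → ΣL (allFin r) (λ c → [ injective φ ] * k φ (lookup φ c)))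
    ≡⟨ cong₂ _+_ fresh repeated ⟩
  mixedSum m (ℕ.suc r) (g ∘ restrictPat (moveFresh m r)) G +
  ΣL (allFin r) (λ c → mixedSum m r (g ∘ restrictPat (dropRepeat m r c)) G) ∎
  where
  V : List (Fin (n G))
  V = allFin (n G)
  k : Vec (Fin (n G)) r → Fin (n G) → ℚ
  k φ x = ΣL (allV G m) (λ ψ → g (pat G (x ∷ (ψ ++ φ))))
  fresh : ΣL (allV G r) (λ φ → ΣL V (λ x → [ injective (x ∷ φ) ] * k φ x)) ≡
          mixedSum m (ℕ.suc r) (g ∘ restrictPat (moveFresh m r)) G
  fresh = trans (ΣL-swap (allV G r) V _) (≡-sym (trans (ΣVec-suc V r _)
            (ΣL-cong V (λ x → ΣL-cong (allV G r) (λ φ → cong ([ injective (x ∷ φ) ] *_)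
              (ΣL-cong (allV G m) (λ ψ → cong g (≡-sym
                (pat-restrict G (x ∷ (ψ ++ φ)) (ψ ++ (x ∷ φ)) (moveFresh m r) (moveFresh-lookup m r x ψ φ))))))))))
  repeated : ΣL (allV G r) (λ φ → ΣL (allFin r) (λ c → [ injective φ ] * k φ (lookup φ c))) ≡
             ΣL (allFin r) (λ c → mixedSum m r (g ∘ restrictPat (dropRepeat m r c)) G)
  repeated = trans (ΣL-swap (allV G r) (allFin r) _)
    (ΣL-cong (allFin r) (λ c → ΣL-cong (allV G r) (λ φ → cong ([ injective φ ] *_)
      (ΣL-cong (allV G m) (λ ψ → cong g
        (pat-restrict G (lookup φ c ∷ (ψ ++ φ)) (ψ ++ φ) (dropRepeat m r c) (dropRepeat-lookup m r ψ φ c)))))))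

mixedSum-expressible : ∀ m r g → Expressible (m Nat.+ r) (mixedSum m r g)
mixedSum-expressible ℕ.zero r g =
  expressible-ext no-free-part (injectivePatternSum-expressible r g)
  where
  no-free-part : ∀ G → ΣL (allV G r) (λ φ → [ injective φ ] * g (pat G φ)) ≡ mixedSum 0 r g G
  no-free-part G = ΣL-cong (allV G r) (λ φ →
    cong ([ injective φ ] *_) (≡-sym (ΣVec-zero (allFin (n G)) (λ ψ → g (pat G (ψ ++ φ))))))
mixedSum-expressible (ℕ.suc m) r g =
  expressible-ext (λ G → ≡-sym (mixedSum-peel m r g G))
    (expressible-+
      (expressible-mono (NatP.≤-reflexive (NatP.+-suc m r)) (mixedSum-expressible m (ℕ.suc r) gFresh))
      (expressible-ΣL (allFin r) (λ c → mixedSum m r (gRepeat c))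
        (λ c → expressible-mono (NatP.n≤1+n _) (mixedSum-expressible m r (gRepeat c)))))
  where
  gFresh : Pat (m Nat.+ ℕ.suc r) → ℚ
  gFresh = g ∘ restrictPat (moveFresh m r)
  gRepeat : Fin r → Pat (m Nat.+ r) → ℚ
  gRepeat c = g ∘ restrictPat (dropRepeat m r c)

patternSum-expressible : ∀ m (g : Pat m → ℚ) → Expressible m (λ G → ΣL (allV G m) (λ ψ → g (pat G ψ)))
patternSum-expressible m g =
  expressible-mono (NatP.≤-reflexive (NatP.+-identityʳ m))
    (expressible-ext no-injective-part (mixedSum-expressible m 0 (g ∘ restrictPat (_↑ˡ 0))))
  where
  no-injective-part : ∀ G → mixedSum m 0 (g ∘ restrictPat (_↑ˡ 0)) G ≡ ΣL (allV G m) (λ ψ → g (pat G ψ))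
  no-injective-part G =
    trans (ΣVec-zero (allFin (n G)) (λ φ → [ injective φ ] * ΣL (allV G m) (λ ψ → g (restrictPat (_↑ˡ 0) (pat G (ψ ++ φ))))))
          (trans (ℚP.*-identityˡ _) (ΣL-cong (allV G m) (λ ψ → cong g
      (≡-sym (pat-restrict G ψ (ψ ++ []) (_↑ˡ 0) (λ a → ≡-sym (VecP.lookup-++ˡ ψ [] a)))))))

-- Each vertex
-- set S with H[S] ≅ J is the image of exactly aut(J) embeddings, so
--   s(J,H) · aut(J) = #embeddings J → H.

respectsAdj : (J H : Graph) → Vec (Fin (n H)) (n J) → Bool
respectsAdj J H φ = allB (λ a → allB (λ b → adj J a b =ᵇ adj H (lookup φ a) (lookup φ b)))

RespectsAdj : (J H : Graph) → Vec (Fin (n H)) (n J) → Set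
RespectsAdj J H φ = ∀ a b → adj J a b ≡ adj H (lookup φ a) (lookup φ b)

respectsAdj⇒ : ∀ J H φ → respectsAdj J H φ ≡ true → RespectsAdj J H φ
respectsAdj⇒ J H φ e a b = =ᵇ-true (allB-true _ (allB-true _ e a) b)

⇒respectsAdj : ∀ J H φ → RespectsAdj J H φ → respectsAdj J H φ ≡ true
⇒respectsAdj J H φ h = allB-intro _ λ a → allB-intro _ λ b →
  trans (cong (_=ᵇ adj H (lookup φ a) (lookup φ b)) (h a b)) (=ᵇ-refl _)

isEmbedding : (J H : Graph) → Vec (Fin (n H)) (n J) → Bool
isEmbedding J H φ = injective φ ∧ respectsAdj J H φ

embeddingCount : Graph → Graph → ℚ
embeddingCount J H = ΣL (allV H (n J)) (λ φ → [ isEmbedding J H φ ])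

autCount : Graph → ℕ
autCount J = countL (isEmbedding J J) (allV J (n J))

record IsIsoOnto (J H : Graph) (φ : Vec (Fin (n H)) (n J)) (S : Vec Bool (n H)) : Set where
  field
    inj      : Inj φ
    image    : ∀ x → lookup S x ≡ memb x φ
    respects : RespectsAdj J H φ

isoOnto⇒ : ∀ J H φ S → isoOnto J H φ S ≡ true → IsIsoOnto J H φ S
isoOnto⇒ J H φ S e = record
  { inj = injective⇒Inj φ (proj₁ e₁₂₃)
  ; image = λ x → =ᵇ-true (allB-true _ (proj₁ e₂₃) x)
  ; respects = respectsAdj⇒ J H φ (proj₂ e₂₃) }
  where
  e₁₂₃ : injective φ ≡ true × allB (λ x → lookup S x =ᵇ memb x φ) ∧ respectsAdj J H φ ≡ true
  e₁₂₃ = ∧-true {injective φ} e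
  e₂₃ : allB (λ x → lookup S x =ᵇ memb x φ) ≡ true × respectsAdj J H φ ≡ true
  e₂₃ = ∧-true {allB (λ x → lookup S x =ᵇ memb x φ)} (proj₂ e₁₂₃)

⇒isoOnto : ∀ J H φ S → IsIsoOnto J H φ S → isoOnto J H φ S ≡ true
⇒isoOnto J H φ S iso =
  ∧-intro (Inj⇒injective φ (IsIsoOnto.inj iso))
    (∧-intro (allB-intro _ (λ x → trans (cong (_=ᵇ memb x φ) (IsIsoOnto.image iso x)) (=ᵇ-refl _)))
             (⇒respectsAdj J H φ (IsIsoOnto.respects iso)))

vec-ext : ∀ {A : Set} {m} {v w : Vec A m} → (∀ a → lookup v a ≡ lookup w a) → v ≡ w
vec-ext {v = v} {w} e = trans (≡-sym (VecP.tabulate∘lookup v)) (trans (VecP.tabulate-cong e) (VecP.tabulate∘lookup w))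

Inj⇒onto : ∀ {m} (σ : Vec (Fin m) m) → Inj σ → ∀ c → ∃ λ a → lookup σ a ≡ c
Inj⇒onto {ℕ.suc m} σ inj c with FinP.any? (λ a → lookup σ a Fin.≟ c)
... | yes hit = hit
... | no miss = ⊥-elim (NatP.<-irrefl refl (FinP.injective⇒≤ {f = avoid} avoid-injective))
  where
  avoid : Fin (ℕ.suc m) → Fin m
  avoid a = Fin.punchOut {i = c} {j = lookup σ a} (λ eq → miss (a , ≡-sym eq))
  avoid-injective : ∀ {a b} → avoid a ≡ avoid b → a ≡ b
  avoid-injective {a} {b} e =
    inj a b (FinP.punchOut-injective (λ eq → miss (a , ≡-sym eq)) (λ eq → miss (b , ≡-sym eq)) e)

ΣVec-bijection : ∀ {k₁ k₂ m} (P : Vec (Fin k₁) m → Bool) (Q : Vec (Fin k₂) m → Bool)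
  (f : Vec (Fin k₁) m → Vec (Fin k₂) m) (g : Vec (Fin k₂) m → Vec (Fin k₁) m) →
  (∀ a → P a ≡ true → Q (f a) ≡ true) → (∀ b → Q b ≡ true → P (g b) ≡ true) →
  (∀ a → P a ≡ true → g (f a) ≡ a) → (∀ b → Q b ≡ true → f (g b) ≡ b) →
  ΣL (allVecs (Fin k₁) (allFin k₁) m) (λ a → [ P a ]) ≡ ΣL (allVecs (Fin k₂) (allFin k₂) m) (λ b → [ Q b ])
ΣVec-bijection {k₁} {k₂} {m} P Q f g fP gQ gf fg = begin
  ΣL As (λ a → [ P a ])
    ≡⟨ ΣL-cong As (λ a → trans (≡-sym (ℚP.*-identityʳ [ P a ])) (cong ([ P a ] *_) (≡-sym (one k₂ (f a))))) ⟩
  ΣL As (λ a → [ P a ] * ΣL Bs (λ b → [ vecEq _=ᶠ_ b (f a) ]))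
    ≡⟨ ΣL-cong As (λ a → ΣL-*ˡ [ P a ] Bs _) ⟩
  ΣL As (λ a → ΣL Bs (λ b → [ P a ] * [ vecEq _=ᶠ_ b (f a) ]))
    ≡⟨ ΣL-swap As Bs _ ⟩
  ΣL Bs (λ b → ΣL As (λ a → [ P a ] * [ vecEq _=ᶠ_ b (f a) ]))
    ≡⟨ ΣL-cong Bs (λ b → ΣL-cong As (λ a → matched a b)) ⟩
  ΣL Bs (λ b → ΣL As (λ a → [ Q b ] * [ vecEq _=ᶠ_ a (g b) ]))
    ≡⟨ ΣL-cong Bs (λ b → ≡-sym (ΣL-*ˡ [ Q b ] As _)) ⟩
  ΣL Bs (λ b → [ Q b ] * ΣL As (λ a → [ vecEq _=ᶠ_ a (g b) ]))
    ≡⟨ ΣL-cong Bs (λ b → trans (cong ([ Q b ] *_) (one k₁ (g b))) (ℚP.*-identityʳ [ Q b ])) ⟩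
  ΣL Bs (λ b → [ Q b ]) ∎
  where
  As : List (Vec (Fin k₁) m)
  As = allVecs (Fin k₁) (allFin k₁) m
  Bs : List (Vec (Fin k₂) m)
  Bs = allVecs (Fin k₂) (allFin k₂) m
  one : ∀ k (w : Vec (Fin k) m) → ΣL (allVecs (Fin k) (allFin k) m) (λ v → [ vecEq _=ᶠ_ v w ]) ≡ 1ℚ
  one k = ΣVec-vecEq (allFin k) _=ᶠ_ (finδ-isDelta k) m
  sound : ∀ {k} {v w : Vec (Fin k) m} → vecEq _=ᶠ_ v w ≡ true → v ≡ w
  sound = vecEq-sound _=ᶠ_ =ᶠ-true
  reflexive : ∀ {k} (v : Vec (Fin k) m) → vecEq _=ᶠ_ v v ≡ true
  reflexive = vecEq-refl _=ᶠ_ =ᶠ-refl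
  matched : ∀ a b → [ P a ] * [ vecEq _=ᶠ_ b (f a) ] ≡ [ Q b ] * [ vecEq _=ᶠ_ a (g b) ]
  matched a b = trans (≡-sym ([∧] (P a) _)) (trans (cong [_] (bool-ext to from)) ([∧] (Q b) _))
    where
    to : P a ∧ vecEq _=ᶠ_ b (f a) ≡ true → Q b ∧ vecEq _=ᶠ_ a (g b) ≡ true
    to e with ∧-true {P a} e
    ... | (Pa , b≈fa) with sound {v = b} {w = f a} b≈fa
    ... | refl rewrite fP a Pa | gf a Pa = reflexive a
    from : Q b ∧ vecEq _=ᶠ_ a (g b) ≡ true → P a ∧ vecEq _=ᶠ_ b (f a) ≡ true
    from e with ∧-true {Q b} e
    ... | (Qb , a≈gb) with sound {v = a} {w = g b} a≈gb
    ... | refl rewrite gQ b Qb | fg b Qb = reflexive b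

-- Given one isomorphism φ₀ of J onto H[S], composing with φ₀ is a bijection
-- from the automorphisms of J onto the isomorphisms of J onto H[S].
module Orbit (J H : Graph) (S : Vec Bool (n H)) (φ₀ : Vec (Fin (n H)) (n J))
             (iso₀ : isoOnto J H φ₀ S ≡ true) where
  open IsIsoOnto (isoOnto⇒ J H φ₀ S iso₀) renaming (inj to inj₀; image to image₀; respects to respects₀)

  compose : Vec (Fin (n J)) (n J) → Vec (Fin (n H)) (n J)
  compose σ = tabulate (λ a → lookup φ₀ (lookup σ a))

  -- A preimage of x under φ₀ (defaulting to d when there is none).
  preimage : Fin (n J) → Fin (n H) → Fin (n J)
  preimage d x with FinP.any? (λ c → lookup φ₀ c Fin.≟ x)
  ... | yes (c , _) = c
  ... | no _ = d

  preimage-correct : ∀ d x → (∃ λ c → lookup φ₀ c ≡ x) → lookup φ₀ (preimage d x) ≡ x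
  preimage-correct d x hit with FinP.any? (λ c → lookup φ₀ c Fin.≟ x)
  ... | yes (c , φ₀c≡x) = φ₀c≡x
  ... | no miss = ⊥-elim (miss hit)

  decompose : Vec (Fin (n H)) (n J) → Vec (Fin (n J)) (n J)
  decompose φ = tabulate (λ a → preimage a (lookup φ a))

  lookup-compose : ∀ σ a → lookup (compose σ) a ≡ lookup φ₀ (lookup σ a)
  lookup-compose σ a = VecP.lookup∘tabulate _ a

  compose-iso : ∀ σ → isEmbedding J J σ ≡ true → isoOnto J H (compose σ) S ≡ true
  compose-iso σ e = ⇒isoOnto J H (compose σ) S (record { inj = inj ; image = image ; respects = respects })
    where
    injσ : Inj σ
    injσ = injective⇒Inj σ (proj₁ (∧-true {injective σ} e))
    respectsσ : RespectsAdj J J σ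
    respectsσ = respectsAdj⇒ J J σ (proj₂ (∧-true {injective σ} e))
    inj : Inj (compose σ)
    inj a b eq = injσ a b (inj₀ _ _ (trans (≡-sym (lookup-compose σ a)) (trans eq (lookup-compose σ b))))
    image : ∀ x → lookup S x ≡ memb x (compose σ)
    image x = trans (image₀ x) (bool-ext to from)
      where
      to : memb x φ₀ ≡ true → memb x (compose σ) ≡ true
      to e with memb⇒∃ x φ₀ e
      ... | (c , φ₀c≡x) with Inj⇒onto σ injσ c
      ... | (a , σa≡c) = ∃⇒memb x (compose σ) a (trans (lookup-compose σ a) (trans (cong (lookup φ₀) σa≡c) φ₀c≡x))
      from : memb x (compose σ) ≡ true → memb x φ₀ ≡ true
      from e with memb⇒∃ x (compose σ) e
      ... | (a , eq) = ∃⇒memb x φ₀ (lookup σ a) (trans (≡-sym (lookup-compose σ a)) eq)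
    respects : RespectsAdj J H (compose σ)
    respects a b = trans (respectsσ a b) (trans (respects₀ (lookup σ a) (lookup σ b))
                     (≡-sym (cong₂ (adj H) (lookup-compose σ a) (lookup-compose σ b))))

  module _ (φ : Vec (Fin (n H)) (n J)) (isoφ : isoOnto J H φ S ≡ true) where
    open IsIsoOnto (isoOnto⇒ J H φ S isoφ)

    compose-decompose-lookup : ∀ a → lookup φ₀ (lookup (decompose φ) a) ≡ lookup φ a
    compose-decompose-lookup a = trans (cong (lookup φ₀) (VecP.lookup∘tabulate _ a)) (preimage-correct a (lookup φ a) in-image₀)
      where
      in-image₀ : ∃ λ c → lookup φ₀ c ≡ lookup φ a
      in-image₀ = memb⇒∃ (lookup φ a) φ₀
        (trans (≡-sym (image₀ (lookup φ a))) (trans (image (lookup φ a)) (∃⇒memb (lookup φ a) φ a refl)))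

    decompose-aut : isEmbedding J J (decompose φ) ≡ true
    decompose-aut = ∧-intro (Inj⇒injective (decompose φ) inj-d) (⇒respectsAdj J J (decompose φ) respects-d)
      where
      inj-d : Inj (decompose φ)
      inj-d a b eq = inj a b (trans (≡-sym (compose-decompose-lookup a))
                               (trans (cong (lookup φ₀) eq) (compose-decompose-lookup b)))
      respects-d : RespectsAdj J J (decompose φ)
      respects-d a b = trans (respects a b) (trans (≡-sym (cong₂ (adj H) (compose-decompose-lookup a) (compose-decompose-lookup b)))
                                                   (≡-sym (respects₀ (lookup (decompose φ) a) (lookup (decompose φ) b))))

    compose-decompose : compose (decompose φ) ≡ φ
    compose-decompose = vec-ext λ a → trans (lookup-compose (decompose φ) a) (compose-decompose-lookup a)

  decompose-compose : ∀ σ → isEmbedding J J σ ≡ true → decompose (compose σ) ≡ σ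
  decompose-compose σ _ = vec-ext λ a → inj₀ _ _ (trans (cong (lookup φ₀) (VecP.lookup∘tabulate _ a))
    (trans (preimage-correct a (lookup (compose σ) a) (lookup σ a , ≡-sym (lookup-compose σ a))) (lookup-compose σ a)))

  orbit : ΣL (allV J (n J)) (λ σ → [ isEmbedding J J σ ]) ≡ ΣL (allV H (n J)) (λ φ → [ isoOnto J H φ S ])
  orbit = ΣVec-bijection (isEmbedding J J) (λ φ → isoOnto J H φ S) compose decompose
            compose-iso decompose-aut decompose-compose compose-decompose

ΣSets-isoOnto : (J H : Graph) (φ : Vec (Fin (n H)) (n J)) →
  ΣL (allVecs Bool bools (n H)) (λ S → [ isoOnto J H φ S ]) ≡ [ isEmbedding J H φ ]
ΣSets-isoOnto J H φ = begin
  ΣL Ss (λ S → [ isoOnto J H φ S ])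
    ≡⟨ ΣL-cong Ss (λ S → split (injective φ) (imageIs S) (respectsAdj J H φ)) ⟩
  ΣL Ss (λ S → [ isEmbedding J H φ ] * [ imageIs S ])
    ≡⟨ ≡-sym (ΣL-*ˡ [ isEmbedding J H φ ] Ss (λ S → [ imageIs S ])) ⟩
  [ isEmbedding J H φ ] * ΣL Ss (λ S → [ imageIs S ])
    ≡⟨ cong ([ isEmbedding J H φ ] *_) (trans (ΣL-cong Ss (λ S → cong [_] (imageIs-vecEq S)))
                                             (ΣVec-vecEq bools _=ᵇ_ boolδ-isDelta (n H) image)) ⟩
  [ isEmbedding J H φ ] * 1ℚ
    ≡⟨ ℚP.*-identityʳ _ ⟩
  [ isEmbedding J H φ ] ∎
  where
  Ss : List (Vec Bool (n H))
  Ss = allVecs Bool bools (n H)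
  image : Vec Bool (n H)
  image = tabulate (λ x → memb x φ)
  imageIs : Vec Bool (n H) → Bool
  imageIs S = allB (λ x → lookup S x =ᵇ memb x φ)
  imageIs-vecEq : ∀ S → imageIs S ≡ vecEq _=ᵇ_ S image
  imageIs-vecEq S = trans (allB-cong _ _ (λ x → cong (lookup S x =ᵇ_) (≡-sym (VecP.lookup∘tabulate (λ x → memb x φ) x))))
                          (allB-vecEq _=ᵇ_ S image)
  split : ∀ a b c → [ a ∧ (b ∧ c) ] ≡ [ a ∧ c ] * [ b ]
  split true true c = ≡-sym (ℚP.*-identityʳ [ c ])
  split true false c = ≡-sym (ℚP.*-zeroʳ [ c ])
  split false b c = ≡-sym (ℚP.*-zeroˡ [ b ])

s-times-aut : (J H : Graph) → ιn (s J H) * ιn (autCount J) ≡ embeddingCount J H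
s-times-aut J H = ≡-sym (begin
  ΣL Φ (λ φ → [ isEmbedding J H φ ])
    ≡⟨ ΣL-cong Φ (λ φ → ≡-sym (ΣSets-isoOnto J H φ)) ⟩
  ΣL Φ (λ φ → ΣL Ss (λ S → [ isoOnto J H φ S ]))
    ≡⟨ ΣL-swap Φ Ss _ ⟩
  ΣL Ss (λ S → ΣL Φ (λ φ → [ isoOnto J H φ S ]))
    ≡⟨ ΣL-cong Ss per-set ⟩
  ΣL Ss (λ S → [ hasIso S ] * aut)
    ≡⟨ ≡-sym (ΣL-*ʳ aut Ss _) ⟩
  ΣL Ss (λ S → [ hasIso S ]) * aut
    ≡⟨ cong₂ _*_ (≡-sym (ι-countL hasIso Ss)) (≡-sym (ι-countL (isEmbedding J J) (allV J (n J)))) ⟩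
  ιn (s J H) * ιn (autCount J) ∎)
  where
  Φ : List (Vec (Fin (n H)) (n J))
  Φ = allV H (n J)
  Ss : List (Vec Bool (n H))
  Ss = allVecs Bool bools (n H)
  hasIso : Vec Bool (n H) → Bool
  hasIso S = anyL (λ φ → isoOnto J H φ S) Φ
  aut : ℚ
  aut = ΣL (allV J (n J)) (λ σ → [ isEmbedding J J σ ])
  per-set : ∀ S → ΣL Φ (λ φ → [ isoOnto J H φ S ]) ≡ [ hasIso S ] * aut
  per-set S with hasIso S in has
  ... | true = let (φ₀ , _ , iso₀) = anyL-true (λ φ → isoOnto J H φ S) Φ has in
               trans (≡-sym (Orbit.orbit J H S φ₀ iso₀)) (≡-sym (ℚP.*-identityˡ aut))
  ... | false = trans (anyL-false (λ φ → isoOnto J H φ S) Φ has) (≡-sym (ℚP.*-zeroˡ aut))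

∈-allVecs : ∀ {k m} (v : Vec (Fin k) m) → v ∈ allVecs (Fin k) (allFin k) m
∈-allVecs [] = here refl
∈-allVecs {k} {ℕ.suc m} (x ∷ v) =
  ∈-concatMap⁺ (λ y → List.map (y ∷_) (allVecs (Fin k) (allFin k) m)) (lose (∈-allFin x) (∈-map⁺ (x ∷_) (∈-allVecs v)))

-- The identity is an automorphism, so aut(J) ≥ 1.
autCount-positive : (J : Graph) → ∃ λ k → autCount J ≡ ℕ.suc k
autCount-positive J = Nat.pred (autCount J) , ≡-sym (NatP.suc-pred (autCount J) {{Nat.>-nonZero positive}})
  where
  identity : Vec (Fin (n J)) (n J)
  identity = tabulate id
  identity-aut : isEmbedding J J identity ≡ true
  identity-aut = ∧-intro
    (Inj⇒injective identity (λ a b e → trans (≡-sym (VecP.lookup∘tabulate id a)) (trans e (VecP.lookup∘tabulate id b))))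
    (⇒respectsAdj J J identity (λ a b → cong₂ (adj J) (≡-sym (VecP.lookup∘tabulate id a)) (≡-sym (VecP.lookup∘tabulate id b))))
  positive : 0 Nat.< autCount J
  positive = ListP.filter-some (T? ∘ isEmbedding J J) (lose (∈-allVecs identity) (subst T (≡-sym identity-aut) _))

divide-by : ∀ (x y a : ℚ) .{{_ : ℚ.NonZero a}} → x * a ≡ y → x ≡ 1/ a * y
divide-by x y a e = begin
  x              ≡⟨ ≡-sym (ℚP.*-identityʳ x) ⟩
  x * 1ℚ         ≡⟨ cong (x *_) (≡-sym (ℚP.*-inverseʳ a)) ⟩
  x * (a * 1/ a) ≡⟨ ≡-sym (ℚP.*-assoc x a (1/ a)) ⟩
  (x * a) * 1/ a ≡⟨ cong (_* 1/ a) e ⟩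
  y * 1/ a       ≡⟨ ℚP.*-comm y (1/ a) ⟩
  1/ a * y       ∎

s-as-embeddings : (J : Graph) → Σ ℚ (λ c → ∀ H → ιn (s J H) ≡ c * embeddingCount J H)
s-as-embeddings J = 1/ aut , λ H → divide-by (ιn (s J H)) (embeddingCount J H) aut (replace-aut (ιn (s J H)) (s-times-aut J H))
  where
  k : ℕ
  k = proj₁ (autCount-positive J)
  aut : ℚ
  aut = ℚ.mkℚ (+ ℕ.suc k) 0 (Coprime.sym (Coprime.1-coprimeTo (ℕ.suc k)))
  aut≡ : ιn (autCount J) ≡ aut
  aut≡ = trans (cong ιn (proj₂ (autCount-positive J))) (ι-mkℚ (+ ℕ.suc k))
  replace-aut : ∀ x {y} → x * ιn (autCount J) ≡ y → x * aut ≡ y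
  replace-aut x e = trans (cong (x *_) (≡-sym aut≡)) e

lookup-injective : {A : Set} (xs : List A) → Unique xs → ∀ i j → List.lookup xs i ≡ List.lookup xs j → i ≡ j
lookup-injective (x ∷ xs) (_ AllPairs.∷ _) zero zero _ = refl
lookup-injective (x ∷ xs) (x∉xs AllPairs.∷ _) zero (suc j) e = ⊥-elim (All.lookup x∉xs (∈-lookup {xs = xs} j) e)
lookup-injective (x ∷ xs) (x∉xs AllPairs.∷ _) (suc i) zero e = ⊥-elim (All.lookup x∉xs (∈-lookup {xs = xs} i) (≡-sym e))
lookup-injective (x ∷ xs) (_ AllPairs.∷ unique) (suc i) (suc j) e = cong suc (lookup-injective xs unique i j e)

ΣL-lookup : {A : Set} (xs : List A) (f : A → ℚ) → ΣL (allFin (List.length xs)) (λ i → f (List.lookup xs i)) ≡ ΣL xs f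
ΣL-lookup xs f = trans (≡-sym (ΣL-map (List.lookup xs) (allFin (List.length xs)) f))
  (cong (λ l → ΣL l f) (trans (ListP.map-tabulate id (List.lookup xs)) (ListP.tabulate-lookup xs)))

weight : {A : Set} (w : A → ℚ) {m : ℕ} → Vec A m → ℚ
weight w [] = 1ℚ
weight w (x ∷ ψ) = w x * weight w ψ

weight-ΠL : {A : Set} (w : A → ℚ) {m : ℕ} (ψ : Vec A m) → weight w ψ ≡ ΠL (allFin m) (λ a → w (lookup ψ a))
weight-ΠL w [] = refl
weight-ΠL w {ℕ.suc m} (x ∷ ψ) = trans (cong (w x *_) (weight-ΠL w ψ)) (≡-sym (ΠFin-suc m (λ a → w (lookup (x ∷ ψ) a))))

ΣVec-reindex : {A B : Set} (Y : List B) (X : List A) (f : B → A) (w : A → ℚ) →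
  (∀ k → ΣL Y (λ y → k (f y)) ≡ ΣL X (λ x → w x * k x)) →
  ∀ m (F : Vec A m → ℚ) → ΣL (allVecs B Y m) (λ φ → F (Vec.map f φ)) ≡ ΣL (allVecs A X m) (λ ψ → weight w ψ * F ψ)
ΣVec-reindex Y X f w reindex ℕ.zero F =
  trans (ΣVec-zero Y (λ φ → F (Vec.map f φ)))
        (trans (≡-sym (ℚP.*-identityˡ (F []))) (≡-sym (ΣVec-zero X (λ ψ → weight w ψ * F ψ))))
ΣVec-reindex Y X f w reindex (ℕ.suc m) F = begin
  ΣL (allVecs _ Y (ℕ.suc m)) (λ φ → F (Vec.map f φ))
    ≡⟨ ΣVec-suc Y m (λ φ → F (Vec.map f φ)) ⟩
  ΣL Y (λ y → ΣL (allVecs _ Y m) (λ φ → F (f y ∷ Vec.map f φ)))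
    ≡⟨ ΣL-cong Y (λ y → ΣVec-reindex Y X f w reindex m (λ ψ → F (f y ∷ ψ))) ⟩
  ΣL Y (λ y → k (f y))
    ≡⟨ reindex k ⟩
  ΣL X (λ x → w x * k x)
    ≡⟨ ΣL-cong X (λ x → trans (ΣL-*ˡ (w x) (allVecs _ X m) _)
                              (ΣL-cong (allVecs _ X m) (λ ψ → ≡-sym (ℚP.*-assoc (w x) (weight w ψ) _)))) ⟩
  ΣL X (λ x → ΣL (allVecs _ X m) (λ ψ → weight w (x ∷ ψ) * F (x ∷ ψ)))
    ≡⟨ ≡-sym (ΣVec-suc X m (λ ψ → weight w ψ * F ψ)) ⟩
  ΣL (allVecs _ X (ℕ.suc m)) (λ ψ → weight w ψ * F ψ) ∎
  where
  k : _ → ℚ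
  k x = ΣL (allVecs _ X m) (λ ψ → weight w ψ * F (x ∷ ψ))

module InducedSubgraph (G : Graph) (q : Fin (n G) → Bool) where
  U : List (Fin (n G))
  U = filterᵇ q (allFin (n G))
  H : Graph
  H = induced G U

  vertexOf : Fin (List.length U) → Fin (n G)
  vertexOf = List.lookup U

  vertexOf-injective : ∀ i j → vertexOf i ≡ vertexOf j → i ≡ j
  vertexOf-injective = lookup-injective U (UniqueP.filter⁺ (λ x → T? (q x)) (UniqueP.allFin⁺ (n G)))

  ΣVertices : ∀ f → ΣL (allFin (List.length U)) (λ i → f (vertexOf i)) ≡ ΣL (allFin (n G)) (λ x → [ q x ] * f x)
  ΣVertices f = trans (ΣL-lookup U f) (ΣL-filter q (allFin (n G)) f)

  isEmbedding-map : (J : Graph) (φ : Vec (Fin (List.length U)) (n J)) → isEmbedding J H φ ≡ isEmbedding J G (Vec.map vertexOf φ)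
  isEmbedding-map J φ = cong₂ _∧_ injective-map respectsAdj-map
    where
    lookup-map : ∀ a → lookup (Vec.map vertexOf φ) a ≡ vertexOf (lookup φ a)
    lookup-map a = VecP.lookup-map a vertexOf φ
    injective-map : injective φ ≡ injective (Vec.map vertexOf φ)
    injective-map = bool-ext
      (λ e → Inj⇒injective (Vec.map vertexOf φ) (λ a b eq →
        injective⇒Inj φ e a b (vertexOf-injective _ _ (trans (≡-sym (lookup-map a)) (trans eq (lookup-map b))))))
      (λ e → Inj⇒injective φ (λ a b eq →
        injective⇒Inj (Vec.map vertexOf φ) e a b (trans (lookup-map a) (trans (cong vertexOf eq) (≡-sym (lookup-map b))))))
    respectsAdj-map : respectsAdj J H φ ≡ respectsAdj J G (Vec.map vertexOf φ)
    respectsAdj-map = allB-cong _ _ (λ a → allB-cong _ _ (λ b →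
      cong (adj J a b =ᵇ_) (≡-sym (cong₂ (adj G) (lookup-map a) (lookup-map b)))))

  embeddingCount-induced : (J : Graph) →
    embeddingCount J H ≡ ΣL (allV G (n J)) (λ ψ → weight (λ x → [ q x ]) ψ * [ isEmbedding J G ψ ])
  embeddingCount-induced J =
    trans (ΣL-cong (allV H (n J)) (λ φ → cong [_] (isEmbedding-map J φ)))
          (ΣVec-reindex (allFin (List.length U)) (allFin (n G)) vertexOf (λ x → [ q x ]) ΣVertices
                        (n J) (λ ψ → [ isEmbedding J G ψ ]))

RootedPatternSum : ℕ → ((G : Graph) → Fin (n G) → ℚ) → Set
RootedPatternSum M F = Σ (Pat (ℕ.suc M) → ℚ) (λ g → ∀ G v → F G v ≡ ΣL (allV G M) (λ ψ → g (pat G (v ∷ ψ))))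

rooted-1 : RootedPatternSum 0 (λ _ _ → 1ℚ)
rooted-1 = (λ _ → 1ℚ) , λ G v → ≡-sym (ΣVec-zero (allFin (n G)) (λ _ → 1ℚ))

-- Products: concatenate the two tuples after the common root.
rooted-* : ∀ {M₁ M₂ F₁ F₂} → RootedPatternSum M₁ F₁ → RootedPatternSum M₂ F₂ →
  RootedPatternSum (M₁ Nat.+ M₂) (λ G v → F₁ G v * F₂ G v)
rooted-* {M₁} {M₂} {F₁} {F₂} (g₁ , F₁≡) (g₂ , F₂≡) = g , F≡
  where
  left : Fin (ℕ.suc M₁) → Fin (ℕ.suc (M₁ Nat.+ M₂))
  left zero = zero
  left (suc a) = suc (a ↑ˡ M₂)
  right : Fin (ℕ.suc M₂) → Fin (ℕ.suc (M₁ Nat.+ M₂))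
  right zero = zero
  right (suc b) = suc (M₁ ↑ʳ b)
  g : Pat (ℕ.suc (M₁ Nat.+ M₂)) → ℚ
  g P = g₁ (restrictPat left P) * g₂ (restrictPat right P)
  F≡ : ∀ G v → F₁ G v * F₂ G v ≡ ΣL (allV G (M₁ Nat.+ M₂)) (λ ψ → g (pat G (v ∷ ψ)))
  F≡ G v = begin
    F₁ G v * F₂ G v
      ≡⟨ cong₂ _*_ (F₁≡ G v) (F₂≡ G v) ⟩
    ΣL (allV G M₁) (λ ψ₁ → g₁ (pat G (v ∷ ψ₁))) * ΣL (allV G M₂) (λ ψ₂ → g₂ (pat G (v ∷ ψ₂)))
      ≡⟨ ΣL-*ʳ _ (allV G M₁) _ ⟩
    ΣL (allV G M₁) (λ ψ₁ → g₁ (pat G (v ∷ ψ₁)) * ΣL (allV G M₂) (λ ψ₂ → g₂ (pat G (v ∷ ψ₂))))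
      ≡⟨ ΣL-cong (allV G M₁) (λ ψ₁ → ΣL-*ˡ (g₁ (pat G (v ∷ ψ₁))) (allV G M₂) (λ ψ₂ → g₂ (pat G (v ∷ ψ₂)))) ⟩
    ΣL (allV G M₁) (λ ψ₁ → ΣL (allV G M₂) (λ ψ₂ → g₁ (pat G (v ∷ ψ₁)) * g₂ (pat G (v ∷ ψ₂))))
      ≡⟨ ΣL-cong (allV G M₁) (λ ψ₁ → ΣL-cong (allV G M₂) (λ ψ₂ → cong₂ _*_
           (cong g₁ (pat-restrict G (v ∷ ψ₁) (v ∷ (ψ₁ ++ ψ₂)) left (left-lookup ψ₁ ψ₂)))
           (cong g₂ (pat-restrict G (v ∷ ψ₂) (v ∷ (ψ₁ ++ ψ₂)) right (right-lookup ψ₁ ψ₂))))) ⟩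
    ΣL (allV G M₁) (λ ψ₁ → ΣL (allV G M₂) (λ ψ₂ → g (pat G (v ∷ (ψ₁ ++ ψ₂)))))
      ≡⟨ ≡-sym (ΣVec-++ (allFin (n G)) M₁ M₂ (λ ψ → g (pat G (v ∷ ψ)))) ⟩
    ΣL (allV G (M₁ Nat.+ M₂)) (λ ψ → g (pat G (v ∷ ψ))) ∎
    where
    left-lookup : ∀ ψ₁ ψ₂ a → lookup (v ∷ ψ₁) a ≡ lookup (v ∷ (ψ₁ ++ ψ₂)) (left a)
    left-lookup ψ₁ ψ₂ zero = refl
    left-lookup ψ₁ ψ₂ (suc a) = ≡-sym (VecP.lookup-++ˡ ψ₁ ψ₂ a)
    right-lookup : ∀ ψ₁ ψ₂ b → lookup (v ∷ ψ₂) b ≡ lookup (v ∷ (ψ₁ ++ ψ₂)) (right b)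
    right-lookup ψ₁ ψ₂ zero = refl
    right-lookup ψ₁ ψ₂ (suc b) = ≡-sym (VecP.lookup-++ʳ ψ₁ ψ₂ b)

rooted-ΠL : (F : Graph → (G : Graph) → Fin (n G) → ℚ) → (∀ J → RootedPatternSum (n J) (F J)) →
  (Js : List Graph) → RootedPatternSum (sum (List.map n Js)) (λ G v → ΠL Js (λ J → F J G v))
rooted-ΠL F rooted [] = rooted-1
rooted-ΠL F rooted (J ∷ Js) = rooted-* (rooted J) (rooted-ΠL F rooted Js)

s-induced-rooted : (J : Graph) (q : (G : Graph) → Fin (n G) → Fin (n G) → Bool) (q̂ : Bool × Bool → Bool × Bool → Bool) →
  (∀ G v u → q G v u ≡ q̂ (v =ᶠ u , adj G v u) (u =ᶠ v , adj G u v)) →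
  RootedPatternSum (n J) (λ G v → ιn (s J (induced G (filterᵇ (q G v) (allFin (n G))))))
s-induced-rooted J q q̂ q≡ = g , s≡
  where
  m : ℕ
  m = n J
  c : ℚ
  c = proj₁ (s-as-embeddings J)
  -- The Boolean data of positions a, b (0 being the root) in a pattern.
  e : Pat (ℕ.suc m) → Fin (ℕ.suc m) → Fin (ℕ.suc m) → Bool × Bool
  e P a b = lookup (lookup P a) b
  insideP : Pat (ℕ.suc m) → ℚ
  insideP P = ΠL (allFin m) (λ a → [ q̂ (e P zero (suc a)) (e P (suc a) zero) ])
  injectiveP respectsP : Pat (ℕ.suc m) → Bool
  injectiveP P = allB λ a → allB λ b → a =ᶠ b ∨ not (proj₁ (e P (suc a) (suc b)))
  respectsP P = allB λ a → allB λ b → adj J a b =ᵇ proj₂ (e P (suc a) (suc b))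
  g : Pat (ℕ.suc m) → ℚ
  g P = c * (insideP P * [ injectiveP P ∧ respectsP P ])
  s≡ : ∀ G v → ιn (s J (induced G (filterᵇ (q G v) (allFin (n G))))) ≡ ΣL (allV G m) (λ ψ → g (pat G (v ∷ ψ)))
  s≡ G v = begin
    ιn (s J H)
      ≡⟨ proj₂ (s-as-embeddings J) H ⟩
    c * embeddingCount J H
      ≡⟨ cong (c *_) (InducedSubgraph.embeddingCount-induced G (q G v) J) ⟩
    c * ΣL (allV G m) (λ ψ → weight (λ x → [ q G v x ]) ψ * [ isEmbedding J G ψ ])
      ≡⟨ ΣL-*ˡ c (allV G m) _ ⟩
    ΣL (allV G m) (λ ψ → c * (weight (λ x → [ q G v x ]) ψ * [ isEmbedding J G ψ ]))
      ≡⟨ ΣL-cong (allV G m) (λ ψ → cong (c *_) (cong₂ _*_ (weight≡ ψ) (cong [_] (cong₂ _∧_ (injective≡ ψ) (respects≡ ψ))))) ⟩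
    ΣL (allV G m) (λ ψ → g (pat G (v ∷ ψ))) ∎
    where
    H : Graph
    H = induced G (filterᵇ (q G v) (allFin (n G)))
    entry≡ : ∀ ψ a b → e (pat G (v ∷ ψ)) a b ≡
                       (lookup (v ∷ ψ) a =ᶠ lookup (v ∷ ψ) b , adj G (lookup (v ∷ ψ) a) (lookup (v ∷ ψ) b))
    entry≡ ψ = lookup²-tabulate (λ a b → (lookup (v ∷ ψ) a =ᶠ lookup (v ∷ ψ) b , adj G (lookup (v ∷ ψ) a) (lookup (v ∷ ψ) b)))
    weight≡ : ∀ ψ → weight (λ x → [ q G v x ]) ψ ≡ insideP (pat G (v ∷ ψ))
    weight≡ ψ = trans (weight-ΠL _ ψ) (ΠL-cong (allFin m) (λ a → cong [_]
      (trans (q≡ G v (lookup ψ a)) (≡-sym (cong₂ q̂ (entry≡ ψ zero (suc a)) (entry≡ ψ (suc a) zero))))))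
    injective≡ : ∀ ψ → injective ψ ≡ injectiveP (pat G (v ∷ ψ))
    injective≡ ψ = allB-cong _ _ (λ a → allB-cong _ _ (λ b →
      cong (λ z → a =ᶠ b ∨ not z) (≡-sym (cong proj₁ (entry≡ ψ (suc a) (suc b))))))
    respects≡ : ∀ ψ → respectsAdj J G ψ ≡ respectsP (pat G (v ∷ ψ))
    respects≡ ψ = allB-cong _ _ (λ a → allB-cong _ _ (λ b →
      cong (adj J a b =ᵇ_) (≡-sym (cong proj₂ (entry≡ ψ (suc a) (suc b))))))

s-minus-rooted : ∀ J → RootedPatternSum (n J) (λ G v → ιn (s J (minus G v)))
s-minus-rooted J = s-induced-rooted J (λ G v u → not (adj G v u) ∧ not (u =ᶠ v))
                                      (λ vu uv → not (proj₂ vu) ∧ not (proj₁ uv)) (λ _ _ _ → refl)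

s-plus-rooted : ∀ J → RootedPatternSum (n J) (λ G v → ιn (s J (plus G v)))
s-plus-rooted J = s-induced-rooted J (λ G v u → adj G v u) (λ vu _ → proj₂ vu) (λ _ _ _ → refl)

lhsTerm : List Graph → List Graph → (G : Graph) → Fin (n G) → ℚ
lhsTerm Js Js' G v = ΠL Js (λ J → ιn (s J (minus G v))) * ΠL Js' (λ J → ιn (s J (plus G v)))

lhs-ΣL : ∀ Js Js' G → ιn (lhs Js Js' G) ≡ ΣL (allFin (n G)) (lhsTerm Js Js' G)
lhs-ΣL Js Js' G = trans (ιn-sum _ (allFin (n G))) (ΣL-cong (allFin (n G)) (λ v →
  trans (ιn-* (product (List.map (λ J → s J (minus G v)) Js)) (product (List.map (λ J → s J (plus G v)) Js')))
        (cong₂ _*_ (ιn-product (λ J → s J (minus G v)) Js) (ιn-product (λ J → s J (plus G v)) Js'))))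

lhsTerm-rooted : ∀ Js Js' → RootedPatternSum (sum (List.map n Js) Nat.+ sum (List.map n Js')) (lhsTerm Js Js')
lhsTerm-rooted Js Js' = rooted-* (rooted-ΠL (λ J G v → ιn (s J (minus G v))) s-minus-rooted Js)
                                 (rooted-ΠL (λ J G v → ιn (s J (plus G v))) s-plus-rooted Js')

-- Summing the rooted pattern sum over the root v gives a pattern sum of
-- arity K = 1 + M, which is K-expressible by (A).
mainTheorem1 : (Js Js' : List Graph) →
    ∃[ 𝒥 ] (All (λ p → n (proj₁ p) ≤ bigK Js Js') 𝒥
    × ((G : Graph) → (+ lhs Js Js' G) / 1 ≡ rhs 𝒥 G))
mainTheorem1 Js Js' = expressible-ext lhs≡ (patternSum-expressible (ℕ.suc M) g)
  where
  M : ℕ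
  M = sum (List.map n Js) Nat.+ sum (List.map n Js')
  g : Pat (ℕ.suc M) → ℚ
  g = proj₁ (lhsTerm-rooted Js Js')
  lhs≡ : ∀ G → ΣL (allV G (ℕ.suc M)) (λ ψ → g (pat G ψ)) ≡ ιn (lhs Js Js' G)
  lhs≡ G = begin
    ΣL (allV G (ℕ.suc M)) (λ ψ → g (pat G ψ))
      ≡⟨ ΣVec-suc (allFin (n G)) M (λ ψ → g (pat G ψ)) ⟩
    ΣL (allFin (n G)) (λ v → ΣL (allV G M) (λ ψ → g (pat G (v ∷ ψ))))
      ≡⟨ ≡-sym (ΣL-cong (allFin (n G)) (proj₂ (lhsTerm-rooted Js Js') G)) ⟩
    ΣL (allFin (n G)) (lhsTerm Js Js' G)
      ≡⟨ ≡-sym (lhs-ΣL Js Js' G) ⟩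
    ιn (lhs Js Js' G) ∎
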